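{- Let $G$ be an $\{\mathrm{ISK4},\mathrm{wheel}\}$-free trigraph, let $H$ be an inclusion-wise maximal induced subtrigraph of $G$ that is a thick complete bipartite trigraph, let $(A,B)$ be a bipartition of $H$, and let $C$ be a component of $G\setminus V(H)$. Then the attachment of $C$ over $H$ contains at most one vertex of $A$ and at most one vertex of $B$.
   Context: A trigraph $G$ is a finite set $V(G)$ with a function $\theta_G$ from 2-element subsets to $\{ -1,0,1\}$; $uv$ is strongly adjacent if $\theta_G(uv)=1$, semi-adjacent if $0$, strongly anti-adjacent if $-1$, adjacent if $\ge0$ (neighbor). A realization is a graph obtained by turning each semi-adjacent pair into an edge or non-edge; the full realization makes them all edges. $G$ is $\{\mathrm{ISK4},\mathrm{wheel}\}$-free if no realization contains an induced subgraph isomorphic to a subdivision of $K_4$ or to a wheel (a chordless cycle plus a vertex with at least three neighbors on it). Induced subtrigraphs restrict $\theta_G$; $G\setminus X=G[V(G)\setminus X]$. A trigraph is connected if its full realization is; a component is a maximal connected induced subtrigraph. A complete bipartite trigraph is one whose vertex set partitions into two strongly stable sets $A,B$ (pairwise strongly anti-adjacent within each) with $A$ strongly complete to $B$ (all pairs across strongly adjacent); $(A,B)$ is a bipartition; thick means $|A|,|B|\ge3$. The attachment of $C$ over $H$ is the set of vertices of $H$ having a neighbor in $C$. -}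

module Defs where

open import Data.Nat using (ℕ; zero; suc; _+_; _≤_; _%_)
open import Data.Fin using (Fin; toℕ) renaming (zero to fz; suc to fs)
open import Data.Fin.Subset using (Subset; _∈_; _∉_; _⊆_; ∁; ∣_∣)
open import Data.Bool using (Bool; true; false)
open import Data.Unit using (⊤; tt)
open import Data.Empty using (⊥)
open import Data.Product using (Σ; ∃; ∃-syntax; _×_; _,_)
open import Data.Sum using (_⊎_; inj₁; inj₂)
open import Relation.Nullary using (¬_)
open import Relation.Binary.PropositionalEquality using (_≡_; _≢_)
open import Relation.Binary.Construct.Closure.ReflexiveTransitive using (Star)
open import Function.Bundles using (_⇔_)

data Tri : Set where
  anti semi strong : Tri   -- θ = -1, 0, 1

record Trigraph (n : ℕ) : Set where
  field
    θ   : Fin n → Fin n → Tri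
    sym : ∀ u v → θ u v ≡ θ v u
open Trigraph public

record InducedCopy (V : Set) (AdjH : V → V → Set) {n : ℕ}
                   (AdjG : Fin n → Fin n → Set) : Set where
  field
    f     : V → Fin n
    inj   : ∀ u v → f u ≡ f v → u ≡ v
    adj⇔  : ∀ u v → u ≢ v → AdjH u v ⇔ AdjG (f u) (f v)

-- Branch vertices Fin 4, the six edges Fin 6,
-- edge e joins end₁ e and end₂ e and is subdivided by ℓ e interior
-- vertices (e , 0) , … , (e , ℓ e - 1), in order from end₁ e to end₂ e.

end₁ end₂ : Fin 6 → Fin 4
end₁ fz = fz
end₁ (fs fz) = fz
end₁ (fs (fs fz)) = fz
end₁ (fs (fs (fs fz))) = fs fz
end₁ (fs (fs (fs (fs fz)))) = fs fz
end₁ (fs (fs (fs (fs (fs fz))))) = fs (fs fz)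
end₂ fz = fs fz
end₂ (fs fz) = fs (fs fz)
end₂ (fs (fs fz)) = fs (fs (fs fz))
end₂ (fs (fs (fs fz))) = fs (fs fz)
end₂ (fs (fs (fs (fs fz)))) = fs (fs (fs fz))
end₂ (fs (fs (fs (fs (fs fz))))) = fs (fs (fs fz))

SubK4V : (Fin 6 → ℕ) → Set
SubK4V ℓ = Fin 4 ⊎ Σ (Fin 6) (λ e → Fin (ℓ e))

BranchInt : (ℓ : Fin 6 → ℕ) → Fin 4 → (e : Fin 6) → Fin (ℓ e) → Set
BranchInt ℓ a e i = (a ≡ end₁ e × toℕ i ≡ 0) ⊎ (a ≡ end₂ e × suc (toℕ i) ≡ ℓ e)

SubK4Adj : (ℓ : Fin 6 → ℕ) → SubK4V ℓ → SubK4V ℓ → Set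
SubK4Adj ℓ (inj₁ a) (inj₁ b) =
  ∃[ e ] (ℓ e ≡ 0 × ((a ≡ end₁ e × b ≡ end₂ e) ⊎ (a ≡ end₂ e × b ≡ end₁ e)))
SubK4Adj ℓ (inj₁ a) (inj₂ (e , i)) = BranchInt ℓ a e i
SubK4Adj ℓ (inj₂ (e , i)) (inj₁ a) = BranchInt ℓ a e i
SubK4Adj ℓ (inj₂ (e , i)) (inj₂ (e' , j)) =
  e ≡ e' × (suc (toℕ i) ≡ toℕ j ⊎ suc (toℕ j) ≡ toℕ i)

-- Wheels: a chordless cycle on Fin k (k ≥ 3, i adjacent to i+1 mod k)
-- plus a centre (inj₂ tt) adjacent exactly to the rim vertices in N,
-- where N has at least three elements.

WheelV : ℕ → Set
WheelV k = Fin k ⊎ ⊤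

CycSucc : (k : ℕ) → Fin k → Fin k → Set
CycSucc k i j = (toℕ j ≡ suc (toℕ i)) ⊎ (suc (toℕ i) ≡ k × toℕ j ≡ 0)

WheelAdj : (k : ℕ) → Subset k → WheelV k → WheelV k → Set
WheelAdj k N (inj₁ i) (inj₁ j) = CycSucc k i j ⊎ CycSucc k j i
WheelAdj k N (inj₁ i) (inj₂ _) = i ∈ N
WheelAdj k N (inj₂ _) (inj₁ j) = j ∈ N
WheelAdj k N (inj₂ _) (inj₂ _) = ⊥

-- Realizations.  A symmetric choice S decides each semi-adjacent pair.

SymChoice : (n : ℕ) → (Fin n → Fin n → Bool) → Set
SymChoice n S = ∀ u v → S u v ≡ S v u

RealAdj : {n : ℕ} → Trigraph n → (Fin n → Fin n → Bool) → Fin n → Fin n → Set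
RealAdj G S u v = u ≢ v × (θ G u v ≡ strong ⊎ (θ G u v ≡ semi × S u v ≡ true))

ISK4WheelFree : {n : ℕ} → Trigraph n → Set
ISK4WheelFree {n} G = ∀ (S : Fin n → Fin n → Bool) → SymChoice n S →
  ((ℓ : Fin 6 → ℕ) → ¬ InducedCopy (SubK4V ℓ) (SubK4Adj ℓ) (RealAdj G S))
  × ((k : ℕ) (N : Subset k) → 3 ≤ k → 3 ≤ ∣ N ∣ →
       ¬ InducedCopy (WheelV k) (WheelAdj k N) (RealAdj G S))

Adjacent : {n : ℕ} → Trigraph n → Fin n → Fin n → Set
Adjacent G u v = u ≢ v × θ G u v ≢ anti

-- Induced subtrigraphs are identified with their vertex sets X : Subset n.

IsBipartition : {n : ℕ} → Trigraph n → Subset n → Subset n → Subset n → Set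
IsBipartition {n} G X A B =
  (∀ v → v ∈ X → (v ∈ A ⊎ v ∈ B))
  × (∀ v → v ∈ A → v ∈ X) × (∀ v → v ∈ B → v ∈ X)
  × (∀ v → v ∈ A → v ∉ B)
  × (∀ u v → u ∈ A → v ∈ A → u ≢ v → θ G u v ≡ anti)
  × (∀ u v → u ∈ B → v ∈ B → u ≢ v → θ G u v ≡ anti)
  × (∀ u v → u ∈ A → v ∈ B → θ G u v ≡ strong)

IsThickCompleteBipartite : {n : ℕ} → Trigraph n → Subset n → Set
IsThickCompleteBipartite G X =
  ∃[ A ] ∃[ B ] (IsBipartition G X A B × 3 ≤ ∣ A ∣ × 3 ≤ ∣ B ∣)

IsMaximalThickCB : {n : ℕ} → Trigraph n → Subset n → Set
IsMaximalThickCB {n} G X = IsThickCompleteBipartite G X ×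
  ((Y : Subset n) → X ⊆ Y → IsThickCompleteBipartite G Y → Y ⊆ X)

-- connectivity of G[C] (via its full realization)
AdjIn : {n : ℕ} → Trigraph n → Subset n → Fin n → Fin n → Set
AdjIn G C u v = u ∈ C × v ∈ C × Adjacent G u v

Connected : {n : ℕ} → Trigraph n → Subset n → Set
Connected G C = ∀ u v → u ∈ C → v ∈ C → Star (AdjIn G C) u v

IsComponentOfMinus : {n : ℕ} → Trigraph n → Subset n → Subset n → Set
IsComponentOfMinus {n} G X C =
  C ⊆ ∁ X × (∃[ c ] c ∈ C) × Connected G C ×
  ((D : Subset n) → C ⊆ D → D ⊆ ∁ X → Connected G D → D ⊆ C)

InAttachment : {n : ℕ} → Trigraph n → Subset n → Subset n → Fin n → Set
InAttachment G X C v = v ∈ X × ∃[ c ] (c ∈ C × Adjacent G v c)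

-- Forbidden subgraphs are exhibited in suitable realizations: an ISK4 from
-- an ISK4 configuration (an induced path and four vertices attached to it
-- in a prescribed way, matched against a combinatorial model of a
-- subdivided K4), and a wheel from a hole together with a vertex having
-- three neighbours on it.  With these tools:
--   1. every bipartition of the thick X is thick (bipartition-thick);
--   2. every vertex x of C has at most one neighbour in A
--      (oneNeighbourInA): two neighbours in A plus one in B give a wheel;
--      with none in B an ISK4 appears, unless x is strongly complete to A
--      and anticomplete to B, when X ∪ {x} contradicts maximality;
--   3. two attachments α ≠ β in A give a walk of G[C] between neighbours
--      of α and of β; a shortest one is a clean induced path (noWalk), and
--      the vertices of B seeing it yield an ISK4 or a wheel (CleanPath).
-- The theorem applies 3 to (A , B) and to (B , A).

module Submission where

open import Defs renaming (sym to θ-sym)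
open import Data.Nat using (ℕ; zero; suc; _+_; _∸_; _≤_; _<_; z≤n; s≤s; _≤?_; _<?_) renaming (_≟_ to _≟ℕ_)
open import Data.Nat.Properties
open import Data.Fin using (Fin; toℕ; fromℕ<) renaming (zero to fz; suc to fs)
open import Data.Fin.Properties using (toℕ<n; toℕ-injective; toℕ-fromℕ<; any?) renaming (_≟_ to _≟F_)
open import Data.Fin.Subset using (Subset; _∈_; _∉_; _⊆_; ∣_∣; inside; outside; _∪_; ⁅_⁆)
open import Data.Fin.Subset.Properties using (_∈?_; ∣p∣≤∣x∷p∣; x∈p∪q⁺; x∈p∪q⁻; x∈⁅x⁆; x∈⁅y⁆⇒x≡y; p⊆q⇒∣p∣≤∣q∣; ∣⁅x⁆∣≡1; x∈∁p⇒x∉p; ∣p∣≤∣p∪q∣; p⊆p∪q)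
open import Data.Vec using (tabulate; _∷_; []; here; there)
open import Data.Vec.Properties using (lookup∘tabulate; []=⇒lookup; lookup⇒[]=)
open import Data.Product using (_×_; _,_; proj₁; proj₂; ∃-syntax)
open import Data.Sum using (_⊎_; inj₁; inj₂; [_,_]′; swap) renaming (map to ⊎-map)
open import Data.Bool using (Bool; true; false; not; _∧_; _∨_)
open import Data.Bool.Properties using (∨-comm)
open import Data.Unit using (⊤; tt)
open import Data.Empty using (⊥; ⊥-elim)
open import Function using (_∘_)
open import Function.Bundles using (_⇔_; mk⇔)
open import Relation.Nullary using (¬_; Dec; yes; no; does)
open import Relation.Nullary.Decidable using (_×-dec_; _⊎-dec_; ¬?; dec-true; dec-false)
open import Relation.Binary using (tri<; tri≈; tri>)
open import Relation.Binary.PropositionalEquality using (_≡_; _≢_; refl; sym; trans; cong; cong₂; subst; subst₂)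
open import Relation.Binary.Construct.Closure.ReflexiveTransitive using (Star; ε; _◅_)
open import Data.Nat.Induction using (<-rec)

-- Logical equivalence as a plain pair, convenient to build and project.
infix 3 _⟺_
_⟺_ : Set → Set → Set
P ⟺ Q = (P → Q) × (Q → P)

does⇒ : ∀ {P : Set} (P? : Dec P) → does P? ≡ true → P
does⇒ (yes p) _ = p
does⇒ (no _) ()

at≤1 : ∀ {Q : ℕ → Set} → Q 0 → Q 1 → ∀ s → s ≤ 1 → Q s
at≤1 q₀ q₁ zero _ = q₀
at≤1 q₀ q₁ (suc zero) _ = q₁
at≤1 q₀ q₁ (suc (suc s)) (s≤s ())

at≤2 : ∀ {Q : ℕ → Set} → Q 0 → Q 1 → Q 2 → ∀ s → s ≤ 2 → Q s
at≤2 q₀ q₁ q₂ zero _ = q₀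
at≤2 {Q} q₀ q₁ q₂ (suc s) s≤ = at≤1 {Q ∘ suc} q₁ q₂ s (≤-pred s≤)

∃≤? : (P : ℕ → Set) → (∀ t → Dec (P t)) → ∀ k → Dec (∃[ t ] (t ≤ k × P t))
∃≤? P P? zero with P? 0
... | yes p = yes (0 , z≤n , p)
... | no ¬p = no λ { (.0 , z≤n , p) → ¬p p }
∃≤? P P? (suc k) with ∃≤? P P? k
... | yes (t , t≤k , p) = yes (t , m≤n⇒m≤1+n t≤k , p)
... | no none with P? (suc k)
...   | yes p = yes (suc k , ≤-refl , p)
...   | no ¬p = no λ { (t , t≤ , p) →
                  [ (λ t<1+k → none (t , ≤-pred t<1+k , p)) , (λ { refl → ¬p p }) ]′ (m≤n⇒m<n∨m≡n t≤) }

leastWitness : (P : ℕ → Set) → (∀ t → Dec (P t)) → ∀ k → ∃[ t ] (t ≤ k × P t) →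
               ∃[ i ] (i ≤ k × P i × (∀ t → t < i → ¬ P t))
leastWitness P P? zero (.0 , z≤n , p) = 0 , z≤n , p , (λ t ())
leastWitness P P? (suc k) (t₀ , t₀≤ , p₀) with ∃≤? P P? k
... | yes below = let (i , i≤k , p , least) = leastWitness P P? k below in
                  i , m≤n⇒m≤1+n i≤k , p , least
... | no none = suc k , ≤-refl , top , (λ t t<1+k pt → none (t , ≤-pred t<1+k , pt))
  where
    top : P (suc k)
    top = [ (λ t₀<1+k → ⊥-elim (none (t₀ , ≤-pred t₀<1+k , p₀))) , (λ e → subst P e p₀) ]′
            (m≤n⇒m<n∨m≡n t₀≤)

∣p∪q∣≤∣p∣+∣q∣ : ∀ {m} (p q : Subset m) → ∣ p ∪ q ∣ ≤ ∣ p ∣ + ∣ q ∣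
∣p∪q∣≤∣p∣+∣q∣ [] [] = z≤n
∣p∪q∣≤∣p∣+∣q∣ (inside ∷ p) (inside ∷ q) =
  s≤s (≤-trans (∣p∪q∣≤∣p∣+∣q∣ p q) (+-monoʳ-≤ ∣ p ∣ (n≤1+n ∣ q ∣)))
∣p∪q∣≤∣p∣+∣q∣ (inside ∷ p) (outside ∷ q) = s≤s (∣p∪q∣≤∣p∣+∣q∣ p q)
∣p∪q∣≤∣p∣+∣q∣ (outside ∷ p) (inside ∷ q) =
  subst (suc ∣ p ∪ q ∣ ≤_) (sym (+-suc ∣ p ∣ ∣ q ∣)) (s≤s (∣p∪q∣≤∣p∣+∣q∣ p q))
∣p∪q∣≤∣p∣+∣q∣ (outside ∷ p) (outside ∷ q) = ∣p∪q∣≤∣p∣+∣q∣ p q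

member : ∀ {m} (p : Subset m) → 1 ≤ ∣ p ∣ → ∃[ i ] i ∈ p
member (inside ∷ p) _ = fz , here
member (outside ∷ p) 1≤∣p∣ = let (i , i∈p) = member p 1≤∣p∣ in fs i , there i∈p

-- A set with at least three elements has an element avoiding any two
-- given points (otherwise it would lie inside ⁅ a ⁆ ∪ ⁅ b ⁆).
avoidTwo : ∀ {m} (p : Subset m) → 3 ≤ ∣ p ∣ → ∀ a b → ∃[ c ] (c ∈ p × c ≢ a × c ≢ b)
avoidTwo {m} p 3≤∣p∣ a b with any? (λ c → c ∈? p ×-dec (¬? (c ≟F a) ×-dec ¬? (c ≟F b)))
... | yes found = found
... | no none = ⊥-elim (<-irrefl refl (≤-trans 3≤∣p∣ ∣p∣≤2))
  where
    p⊆ab : p ⊆ ⁅ a ⁆ ∪ ⁅ b ⁆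
    p⊆ab {c} c∈p with c ≟F a | c ≟F b
    ... | yes refl | _ = x∈p∪q⁺ (inj₁ (x∈⁅x⁆ c))
    ... | no _ | yes refl = x∈p∪q⁺ {p = ⁅ a ⁆} (inj₂ (x∈⁅x⁆ c))
    ... | no c≢a | no c≢b = ⊥-elim (none (c , c∈p , c≢a , c≢b))
    ∣p∣≤2 : ∣ p ∣ ≤ 2
    ∣p∣≤2 = ≤-trans (p⊆q⇒∣p∣≤∣q∣ p⊆ab)
              (≤-trans (∣p∪q∣≤∣p∣+∣q∣ ⁅ a ⁆ ⁅ b ⁆)
                (≤-reflexive (cong₂ _+_ (∣⁅x⁆∣≡1 a) (∣⁅x⁆∣≡1 b))))

private
  member⇒1≤∣p∣ : ∀ {m} {p : Subset m} {i} → i ∈ p → 1 ≤ ∣ p ∣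
  member⇒1≤∣p∣ {p = inside ∷ p} here = s≤s z≤n
  member⇒1≤∣p∣ {p = x ∷ p} (there i∈p) = ≤-trans (member⇒1≤∣p∣ i∈p) (∣p∣≤∣x∷p∣ x p)

  two⇒2≤∣p∣ : ∀ {m} {p : Subset m} {i j} → i ≢ j → i ∈ p → j ∈ p → 2 ≤ ∣ p ∣
  two⇒2≤∣p∣ {p = inside ∷ p} i≢j here here = ⊥-elim (i≢j refl)
  two⇒2≤∣p∣ {p = inside ∷ p} _ here (there j∈p) = s≤s (member⇒1≤∣p∣ j∈p)
  two⇒2≤∣p∣ {p = inside ∷ p} _ (there i∈p) here = s≤s (member⇒1≤∣p∣ i∈p)
  two⇒2≤∣p∣ {p = x ∷ p} i≢j (there i∈p) (there j∈p) =
    ≤-trans (two⇒2≤∣p∣ (i≢j ∘ cong fs) i∈p j∈p) (∣p∣≤∣x∷p∣ x p)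

three⇒3≤∣p∣ : ∀ {m} {p : Subset m} {i j k} → i ≢ j → i ≢ k → j ≢ k →
              i ∈ p → j ∈ p → k ∈ p → 3 ≤ ∣ p ∣
three⇒3≤∣p∣ {p = inside ∷ p} i≢j _ _ here here _ = ⊥-elim (i≢j refl)
three⇒3≤∣p∣ {p = inside ∷ p} _ i≢k _ here _ here = ⊥-elim (i≢k refl)
three⇒3≤∣p∣ {p = inside ∷ p} _ _ j≢k _ here here = ⊥-elim (j≢k refl)
three⇒3≤∣p∣ {p = inside ∷ p} _ _ j≢k here (there j∈p) (there k∈p) =
  s≤s (two⇒2≤∣p∣ (j≢k ∘ cong fs) j∈p k∈p)
three⇒3≤∣p∣ {p = inside ∷ p} _ i≢k _ (there i∈p) here (there k∈p) =
  s≤s (two⇒2≤∣p∣ (i≢k ∘ cong fs) i∈p k∈p)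
three⇒3≤∣p∣ {p = inside ∷ p} i≢j _ _ (there i∈p) (there j∈p) here =
  s≤s (two⇒2≤∣p∣ (i≢j ∘ cong fs) i∈p j∈p)
three⇒3≤∣p∣ {p = x ∷ p} i≢j i≢k j≢k (there i∈p) (there j∈p) (there k∈p) =
  ≤-trans (three⇒3≤∣p∣ (i≢j ∘ cong fs) (i≢k ∘ cong fs) (j≢k ∘ cong fs) i∈p j∈p k∈p)
          (∣p∣≤∣x∷p∣ x p)

_≟T_ : (a b : Tri) → Dec (a ≡ b)
anti ≟T anti = yes refl
anti ≟T semi = no (λ ())
anti ≟T strong = no (λ ())
semi ≟T anti = no (λ ())
semi ≟T semi = yes refl
semi ≟T strong = no (λ ())
strong ≟T anti = no (λ ())
strong ≟T semi = no (λ ())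
strong ≟T strong = yes refl

module _ {n : ℕ} (G : Trigraph n) where

  adjacent-sym : ∀ {u v} → Adjacent G u v → Adjacent G v u
  adjacent-sym {u} {v} (u≢v , ¬anti) = u≢v ∘ sym , ¬anti ∘ trans (θ-sym G u v)

  adjacent? : ∀ u v → Dec (Adjacent G u v)
  adjacent? u v with u ≟F v | θ G u v ≟T anti
  ... | yes u≡v | _ = no (λ adj → proj₁ adj u≡v)
  ... | no _ | yes isAnti = no (λ adj → proj₂ adj isAnti)
  ... | no u≢v | no ¬anti = yes (u≢v , ¬anti)

  realAdj⇒adjacent : ∀ {S u v} → RealAdj G S u v → Adjacent G u v
  realAdj⇒adjacent (u≢v , inj₁ isStrong) = u≢v , λ isAnti → case (trans (sym isStrong) isAnti)
    where case : strong ≢ anti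
          case ()
  realAdj⇒adjacent (u≢v , inj₂ (isSemi , _)) = u≢v , λ isAnti → case (trans (sym isSemi) isAnti)
    where case : semi ≢ anti
          case ()

  adjacent⇒realAdj : ∀ {S u v} → Adjacent G u v → S u v ≡ true → RealAdj G S u v
  adjacent⇒realAdj {S} {u} {v} (u≢v , ¬anti) chosen = u≢v , byθ (θ G u v) ¬anti
    where
      byθ : (t : Tri) → t ≢ anti → t ≡ strong ⊎ (t ≡ semi × S u v ≡ true)
      byθ anti ¬anti = ⊥-elim (¬anti refl)
      byθ semi _ = inj₂ (refl , chosen)
      byθ strong _ = inj₁ refl

  anti⇒¬realAdj : ∀ {S u v} → θ G u v ≡ anti → ¬ RealAdj G S u v
  anti⇒¬realAdj {S} isAnti adj = proj₂ (realAdj⇒adjacent {S = S} adj) isAnti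

  strong⇒realAdj : ∀ {S u v} → u ≢ v → θ G u v ≡ strong → RealAdj G S u v
  strong⇒realAdj u≢v isStrong = u≢v , inj₁ isStrong

-- The full realization turns every semi-adjacent pair into an edge.
full : ∀ {n} → Fin n → Fin n → Bool
full _ _ = true

full-sym : ∀ {n} → SymChoice n full
full-sym _ _ = refl

-- The full realization except that the pair {x , a} is a non-edge.
allBut : ∀ {n} → Fin n → Fin n → Fin n → Fin n → Bool
allBut x a u v = not ((does (u ≟F x) ∧ does (v ≟F a)) ∨ (does (v ≟F x) ∧ does (u ≟F a)))

allBut-sym : ∀ {n} (x a : Fin n) → SymChoice n (allBut x a)
allBut-sym x a u v = cong not (∨-comm (does (u ≟F x) ∧ does (v ≟F a)) (does (v ≟F x) ∧ does (u ≟F a)))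

allBut-pair : ∀ {n} (x a : Fin n) → allBut x a x a ≡ false
allBut-pair x a rewrite dec-true (x ≟F x) refl | dec-true (a ≟F a) refl = refl

allBut-other : ∀ {n} {x a c : Fin n} → c ≢ a → c ≢ x → allBut x a x c ≡ true
allBut-other {x = x} {a} {c} c≢a c≢x
  rewrite dec-true (x ≟F x) refl | dec-false (c ≟F a) c≢a | dec-false (c ≟F x) c≢x = refl

-- This is a subdivision of K4 with branch vertices
-- y, q u, z₁, z₃ (when u ≤ r).

data ModelV : Set where
  KY KZ1 KZ2 KZ3 : ModelV
  KQ : ℕ → ModelV

ModelAdj : ℕ → ℕ → ModelV → ModelV → Set
ModelAdj r u (KQ s) (KQ t) = t ≡ suc s ⊎ s ≡ suc t
ModelAdj r u KY (KQ s) = s ≡ 0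
ModelAdj r u (KQ s) KY = s ≡ 0
ModelAdj r u KZ1 (KQ s) = s ≡ r
ModelAdj r u (KQ s) KZ1 = s ≡ r
ModelAdj r u KZ3 (KQ s) = s ≡ u
ModelAdj r u (KQ s) KZ3 = s ≡ u
ModelAdj r u KY KZ1 = ⊤
ModelAdj r u KZ1 KY = ⊤
ModelAdj r u KY KZ3 = ⊤
ModelAdj r u KZ3 KY = ⊤
ModelAdj r u KZ1 KZ2 = ⊤
ModelAdj r u KZ2 KZ1 = ⊤
ModelAdj r u KZ2 KZ3 = ⊤
ModelAdj r u KZ3 KZ2 = ⊤
ModelAdj r u _ _ = ⊥

modelAdj-sym : ∀ r u a b → ModelAdj r u a b → ModelAdj r u b a
modelAdj-sym r u (KQ s) (KQ t) adj = swap adj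
modelAdj-sym r u KY (KQ s) adj = adj
modelAdj-sym r u (KQ s) KY adj = adj
modelAdj-sym r u KZ1 (KQ s) adj = adj
modelAdj-sym r u (KQ s) KZ1 adj = adj
modelAdj-sym r u KZ3 (KQ s) adj = adj
modelAdj-sym r u (KQ s) KZ3 adj = adj
modelAdj-sym r u KY KZ1 adj = adj
modelAdj-sym r u KZ1 KY adj = adj
modelAdj-sym r u KY KZ3 adj = adj
modelAdj-sym r u KZ3 KY adj = adj
modelAdj-sym r u KZ1 KZ2 adj = adj
modelAdj-sym r u KZ2 KZ1 adj = adj
modelAdj-sym r u KZ2 KZ3 adj = adj
modelAdj-sym r u KZ3 KZ2 adj = adj

kQ-injective : ∀ {s t} → KQ s ≡ KQ t → s ≡ t
kQ-injective refl = refl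

pattern f1 = fs fz
pattern f2 = fs (fs fz)
pattern f3 = fs (fs (fs fz))
pattern f4 = fs (fs (fs (fs fz)))
pattern f5 = fs (fs (fs (fs (fs fz))))

-- The model realised as a subdivision of K4 in the sense of Defs: the
-- branch vertices 0 1 2 3 are y, q u, z₁, z₃, the edge 0–1 carries
-- q 0 … q (u-1), the edge 1–2 carries q (u+1) … q r, the edge 2–3
-- carries z₂, the other three edges are not subdivided.
module K4Model (r u : ℕ) (u≤r : u ≤ r) where
  ℓ : Fin 6 → ℕ
  ℓ fz = u
  ℓ f1 = 0
  ℓ f2 = 0
  ℓ f3 = r ∸ u
  ℓ f4 = 0
  ℓ f5 = 1

  kind : SubK4V ℓ → ModelV
  kind (inj₁ fz) = KY
  kind (inj₁ f1) = KQ u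
  kind (inj₁ f2) = KZ1
  kind (inj₁ f3) = KZ3
  kind (inj₂ (fz , i)) = KQ (toℕ i)
  kind (inj₂ (f3 , i)) = KQ (suc u + toℕ i)
  kind (inj₂ (f5 , i)) = KZ2

  Valid : ModelV → Set
  Valid (KQ s) = s ≤ r
  Valid _ = ⊤

  private
    lastEdge≤r : (i : Fin (r ∸ u)) → suc u + toℕ i ≤ r
    lastEdge≤r i = subst (_≤ r) (+-suc u (toℕ i))
                     (≤-trans (+-monoʳ-≤ u (toℕ<n i)) (≤-reflexive (m+[n∸m]≡n u≤r)))

    firstEdge< : (i : Fin u) (j : ℕ) → toℕ i < suc u + j
    firstEdge< i j = ≤-trans (toℕ<n i) (m≤n⇒m≤1+n (m≤m+n u j))

    only0 : (i : Fin 1) → toℕ i ≡ 0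
    only0 fz = refl

  kind-valid : ∀ v → Valid (kind v)
  kind-valid (inj₁ fz) = tt
  kind-valid (inj₁ f1) = u≤r
  kind-valid (inj₁ f2) = tt
  kind-valid (inj₁ f3) = tt
  kind-valid (inj₂ (fz , i)) = ≤-trans (<⇒≤ (toℕ<n i)) u≤r
  kind-valid (inj₂ (f3 , i)) = lastEdge≤r i
  kind-valid (inj₂ (f5 , i)) = tt

  kind-injective : ∀ v w → kind v ≡ kind w → v ≡ w
  kind-injective (inj₁ fz) (inj₁ fz) _ = refl
  kind-injective (inj₁ f1) (inj₁ f1) _ = refl
  kind-injective (inj₁ f2) (inj₁ f2) _ = refl
  kind-injective (inj₁ f3) (inj₁ f3) _ = refl
  kind-injective (inj₁ fz) (inj₁ f1) ()
  kind-injective (inj₁ fz) (inj₁ f2) ()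
  kind-injective (inj₁ fz) (inj₁ f3) ()
  kind-injective (inj₁ f1) (inj₁ fz) ()
  kind-injective (inj₁ f1) (inj₁ f2) ()
  kind-injective (inj₁ f1) (inj₁ f3) ()
  kind-injective (inj₁ f2) (inj₁ fz) ()
  kind-injective (inj₁ f2) (inj₁ f1) ()
  kind-injective (inj₁ f2) (inj₁ f3) ()
  kind-injective (inj₁ f3) (inj₁ fz) ()
  kind-injective (inj₁ f3) (inj₁ f1) ()
  kind-injective (inj₁ f3) (inj₁ f2) ()
  kind-injective (inj₁ f1) (inj₂ (fz , i)) eq = ⊥-elim (<⇒≢ (toℕ<n i) (sym (kQ-injective eq)))
  kind-injective (inj₁ f1) (inj₂ (f3 , i)) eq = ⊥-elim (m≢1+m+n u (kQ-injective eq))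
  kind-injective (inj₂ (fz , i)) (inj₁ f1) eq = ⊥-elim (<⇒≢ (toℕ<n i) (kQ-injective eq))
  kind-injective (inj₂ (f3 , i)) (inj₁ f1) eq = ⊥-elim (m≢1+m+n u (sym (kQ-injective eq)))
  kind-injective (inj₁ fz) (inj₂ (fz , i)) ()
  kind-injective (inj₁ fz) (inj₂ (f3 , i)) ()
  kind-injective (inj₁ fz) (inj₂ (f5 , i)) ()
  kind-injective (inj₁ f1) (inj₂ (f5 , i)) ()
  kind-injective (inj₁ f2) (inj₂ (fz , i)) ()
  kind-injective (inj₁ f2) (inj₂ (f3 , i)) ()
  kind-injective (inj₁ f2) (inj₂ (f5 , i)) ()
  kind-injective (inj₁ f3) (inj₂ (fz , i)) ()
  kind-injective (inj₁ f3) (inj₂ (f3 , i)) ()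
  kind-injective (inj₁ f3) (inj₂ (f5 , i)) ()
  kind-injective (inj₂ (fz , i)) (inj₁ fz) ()
  kind-injective (inj₂ (fz , i)) (inj₁ f2) ()
  kind-injective (inj₂ (fz , i)) (inj₁ f3) ()
  kind-injective (inj₂ (f3 , i)) (inj₁ fz) ()
  kind-injective (inj₂ (f3 , i)) (inj₁ f2) ()
  kind-injective (inj₂ (f3 , i)) (inj₁ f3) ()
  kind-injective (inj₂ (f5 , i)) (inj₁ fz) ()
  kind-injective (inj₂ (f5 , i)) (inj₁ f1) ()
  kind-injective (inj₂ (f5 , i)) (inj₁ f2) ()
  kind-injective (inj₂ (f5 , i)) (inj₁ f3) ()
  kind-injective (inj₂ (fz , i)) (inj₂ (fz , j)) eq =
    cong (λ k → inj₂ (fz , k)) (toℕ-injective (kQ-injective eq))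
  kind-injective (inj₂ (f3 , i)) (inj₂ (f3 , j)) eq =
    cong (λ k → inj₂ (f3 , k)) (toℕ-injective (+-cancelˡ-≡ (suc u) (toℕ i) (toℕ j) (kQ-injective eq)))
  kind-injective (inj₂ (fz , i)) (inj₂ (f3 , j)) eq = ⊥-elim (<⇒≢ (firstEdge< i (toℕ j)) (kQ-injective eq))
  kind-injective (inj₂ (f3 , i)) (inj₂ (fz , j)) eq =
    ⊥-elim (<⇒≢ (firstEdge< j (toℕ i)) (sym (kQ-injective eq)))
  kind-injective (inj₂ (f5 , fz)) (inj₂ (f5 , fz)) _ = refl
  kind-injective (inj₂ (fz , i)) (inj₂ (f5 , j)) ()
  kind-injective (inj₂ (f3 , i)) (inj₂ (f5 , j)) ()
  kind-injective (inj₂ (f5 , i)) (inj₂ (fz , j)) ()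
  kind-injective (inj₂ (f5 , i)) (inj₂ (f3 , j)) ()

  private
    noInterior⇒u≡r : r ∸ u ≡ 0 → u ≡ r
    noInterior⇒u≡r z = ≤-antisym u≤r (m∸n≡0⇒m≤n z)

    u≡r⇒noInterior : u ≡ r → r ∸ u ≡ 0
    u≡r⇒noInterior refl = n∸n≡0 u

  branchAdj⇒ : ∀ a b → SubK4Adj ℓ (inj₁ a) (inj₁ b) → ModelAdj r u (kind (inj₁ a)) (kind (inj₁ b))
  branchAdj⇒ _ _ (e , unsubdivided , inj₁ (refl , refl)) = edge e unsubdivided
    where
      edge : ∀ e → ℓ e ≡ 0 → ModelAdj r u (kind (inj₁ (end₁ e))) (kind (inj₁ (end₂ e)))
      edge fz u≡0 = u≡0
      edge f1 _ = tt
      edge f2 _ = tt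
      edge f3 z = noInterior⇒u≡r z
      edge f4 _ = refl
      edge f5 ()
  branchAdj⇒ a b (e , unsubdivided , inj₂ (refl , refl)) =
    modelAdj-sym r u _ _ (branchAdj⇒ b a (e , unsubdivided , inj₁ (refl , refl)))

  branchAdj⇐ : ∀ a b → ModelAdj r u (kind (inj₁ a)) (kind (inj₁ b)) → SubK4Adj ℓ (inj₁ a) (inj₁ b)
  branchAdj⇐ fz f1 adj = fz , adj , inj₁ (refl , refl)
  branchAdj⇐ f1 fz adj = fz , adj , inj₂ (refl , refl)
  branchAdj⇐ fz f2 _ = f1 , refl , inj₁ (refl , refl)
  branchAdj⇐ f2 fz _ = f1 , refl , inj₂ (refl , refl)
  branchAdj⇐ fz f3 _ = f2 , refl , inj₁ (refl , refl)
  branchAdj⇐ f3 fz _ = f2 , refl , inj₂ (refl , refl)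
  branchAdj⇐ f1 f2 u≡r = f3 , u≡r⇒noInterior u≡r , inj₁ (refl , refl)
  branchAdj⇐ f2 f1 u≡r = f3 , u≡r⇒noInterior u≡r , inj₂ (refl , refl)
  branchAdj⇐ f1 f3 _ = f4 , refl , inj₁ (refl , refl)
  branchAdj⇐ f3 f1 _ = f4 , refl , inj₂ (refl , refl)
  branchAdj⇐ f1 f1 adj = ⊥-elim (m≢1+m+n u (trans ([ (λ e → e) , (λ e → e) ]′ adj)
                                                     (cong suc (sym (+-identityʳ u)))))
  branchAdj⇐ fz fz ()
  branchAdj⇐ f2 f2 ()
  branchAdj⇐ f2 f3 ()
  branchAdj⇐ f3 f2 ()
  branchAdj⇐ f3 f3 ()

  branchInterior : ∀ a x → SubK4Adj ℓ (inj₁ a) (inj₂ x) ⟺ ModelAdj r u (kind (inj₁ a)) (kind (inj₂ x))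
  branchInterior fz (fz , i) = (λ { (inj₁ (_ , z)) → z ; (inj₂ (() , _)) }) , (λ z → inj₁ (refl , z))
  branchInterior fz (f3 , i) = (λ { (inj₁ (() , _)) ; (inj₂ (() , _)) }) , (λ ())
  branchInterior fz (f5 , i) = (λ { (inj₁ (() , _)) ; (inj₂ (() , _)) }) , (λ ())
  branchInterior f1 (fz , i) =
    (λ { (inj₁ (() , _)) ; (inj₂ (_ , z)) → inj₂ (sym z) }) ,
    (λ { (inj₁ z) → ⊥-elim (<⇒≢ (m≤n⇒m≤1+n (toℕ<n i)) z) ; (inj₂ z) → inj₂ (refl , sym z) })
  branchInterior f1 (f3 , i) =
    (λ { (inj₁ (_ , z)) → inj₁ (trans (cong (suc u +_) z) (+-identityʳ (suc u))) ; (inj₂ (() , _)) }) ,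
    (λ { (inj₁ z) → inj₁ (refl , +-cancelˡ-≡ (suc u) (toℕ i) 0 (trans z (sym (+-identityʳ (suc u)))))
       ; (inj₂ z) → ⊥-elim (m≢1+m+n u (trans z (cong suc (sym (+-suc u (toℕ i)))))) })
  branchInterior f1 (f5 , i) = (λ { (inj₁ (() , _)) ; (inj₂ (() , _)) }) , (λ ())
  branchInterior f2 (fz , i) =
    (λ { (inj₁ (() , _)) ; (inj₂ (() , _)) }) , (λ z → ⊥-elim (<⇒≢ (≤-trans (toℕ<n i) u≤r) z))
  branchInterior f2 (f3 , i) =
    (λ { (inj₁ (() , _)) ; (inj₂ (_ , z)) → trans (sym (+-suc u (toℕ i))) (trans (cong (u +_) z) (m+[n∸m]≡n u≤r)) }) ,
    (λ z → inj₂ (refl , sym (trans (cong (_∸ u) (sym (trans (+-suc u (toℕ i)) z))) (m+n∸m≡n u (suc (toℕ i))))))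
  branchInterior f2 (f5 , i) = (λ _ → tt) , (λ _ → inj₁ (refl , only0 i))
  branchInterior f3 (fz , i) =
    (λ { (inj₁ (() , _)) ; (inj₂ (() , _)) }) , (λ z → ⊥-elim (<⇒≢ (toℕ<n i) z))
  branchInterior f3 (f3 , i) =
    (λ { (inj₁ (() , _)) ; (inj₂ (() , _)) }) , (λ z → ⊥-elim (m≢1+m+n u (sym z)))
  branchInterior f3 (f5 , i) = (λ _ → tt) , (λ _ → inj₂ (refl , cong suc (only0 i)))

  interiorAdj : ∀ x y → x ≢ y → SubK4Adj ℓ (inj₂ x) (inj₂ y) ⟺ ModelAdj r u (kind (inj₂ x)) (kind (inj₂ y))
  interiorAdj (fz , i) (fz , j) _ = (λ { (_ , adj) → ⊎-map sym sym adj }) , (λ adj → refl , ⊎-map sym sym adj)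
  interiorAdj (f3 , i) (f3 , j) _ =
    (λ { (_ , inj₁ z) → inj₁ (trans (cong (suc u +_) (sym z)) (+-suc (suc u) (toℕ i)))
       ; (_ , inj₂ z) → inj₂ (trans (cong (suc u +_) (sym z)) (+-suc (suc u) (toℕ j))) }) ,
    (λ { (inj₁ z) → refl , inj₁ (sym (+-cancelˡ-≡ (suc u) _ _ (trans z (sym (+-suc (suc u) (toℕ i))))))
       ; (inj₂ z) → refl , inj₂ (sym (+-cancelˡ-≡ (suc u) _ _ (trans z (sym (+-suc (suc u) (toℕ j)))))) })
  interiorAdj (fz , i) (f3 , j) _ =
    (λ { (() , _) }) ,
    (λ { (inj₁ z) → ⊥-elim (<⇒≢ (s≤s (≤-trans (toℕ<n i) (m≤m+n u (toℕ j)))) (sym z))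
       ; (inj₂ z) → ⊥-elim (<⇒≢ (m≤n⇒m≤1+n (firstEdge< i (toℕ j))) z) })
  interiorAdj (f3 , i) (fz , j) _ =
    (λ { (() , _) }) ,
    (λ { (inj₁ z) → ⊥-elim (<⇒≢ (m≤n⇒m≤1+n (firstEdge< j (toℕ i))) z)
       ; (inj₂ z) → ⊥-elim (<⇒≢ (s≤s (≤-trans (toℕ<n j) (m≤m+n u (toℕ i)))) (sym z)) })
  interiorAdj (fz , i) (f5 , j) _ = (λ { (() , _) }) , (λ ())
  interiorAdj (f3 , i) (f5 , j) _ = (λ { (() , _) }) , (λ ())
  interiorAdj (f5 , i) (fz , j) _ = (λ { (() , _) }) , (λ ())
  interiorAdj (f5 , i) (f3 , j) _ = (λ { (() , _) }) , (λ ())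
  interiorAdj (f5 , fz) (f5 , fz) x≢y = ⊥-elim (x≢y refl)

  kind-adj : ∀ v w → v ≢ w → SubK4Adj ℓ v w ⟺ ModelAdj r u (kind v) (kind w)
  kind-adj (inj₁ a) (inj₁ b) _ = branchAdj⇒ a b , branchAdj⇐ a b
  kind-adj (inj₁ a) (inj₂ x) _ = branchInterior a x
  kind-adj (inj₂ x) (inj₁ a) _ =
    (λ adj → modelAdj-sym r u _ _ (proj₁ (branchInterior a x) adj)) ,
    (λ adj → proj₂ (branchInterior a x) (modelAdj-sym r u _ _ adj))
  kind-adj (inj₂ x) (inj₂ y) v≢w = interiorAdj x y (v≢w ∘ cong inj₂)

append : ∀ {n} → (ℕ → Fin n) → ℕ → Fin n → ℕ → Fin n
append p m v s with s ≤? m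
... | yes _ = p s
... | no _ = v

append-old : ∀ {n} {p : ℕ → Fin n} {m v} s → s ≤ m → append p m v s ≡ p s
append-old {m = m} s s≤m with s ≤? m
... | yes _ = refl
... | no s≰m = ⊥-elim (s≰m s≤m)

append-new : ∀ {n} {p : ℕ → Fin n} {m v} → append p m v (suc m) ≡ v
append-new {m = m} with suc m ≤? m
... | yes 1+m≤m = ⊥-elim (<-irrefl refl 1+m≤m)
... | no _ = refl

onAppend : ∀ {n} {p : ℕ → Fin n} {m v} (P : ℕ → Fin n → Set) →
           (∀ s → s ≤ m → P s (p s)) → P (suc m) v → ∀ s → s ≤ suc m → P s (append p m v s)
onAppend {p = p} {m} {v} P old new s s≤1+m with m≤n⇒m<n∨m≡n s≤1+m
... | inj₁ s<1+m = subst (P s) (sym (append-old s (≤-pred s<1+m))) (old s (≤-pred s<1+m))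
... | inj₂ refl = subst (P (suc m)) (sym (append-new {p = p} {m} {v})) new

module Realization {n : ℕ} (G : Trigraph n) (S : Fin n → Fin n → Bool) (S-sym : SymChoice n S) where

  R : Fin n → Fin n → Set
  R = RealAdj G S

  R-sym : ∀ {a b} → R a b → R b a
  R-sym {a} {b} (a≢b , inj₁ isStrong) = a≢b ∘ sym , inj₁ (trans (θ-sym G b a) isStrong)
  R-sym {a} {b} (a≢b , inj₂ (isSemi , chosen)) =
    a≢b ∘ sym , inj₂ (trans (θ-sym G b a) isSemi , trans (S-sym b a) chosen)

  R-flip : ∀ {a b} {P : Set} → R a b ⟺ P → R b a ⟺ P
  R-flip (to , from) = to ∘ R-sym , R-sym ∘ from

  -- Adjacency in a realization is decidable (needed to collect wheel spokes).
  R? : ∀ a b → Dec (R a b)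
  R? a b with a ≟F b
  ... | yes a≡b = no (λ adj → proj₁ adj a≡b)
  ... | no a≢b with θ G a b | S a b
  ... | strong | _ = yes (a≢b , inj₁ refl)
  ... | semi | true = yes (a≢b , inj₂ (refl , refl))
  ... | semi | false = no (λ { (_ , inj₁ ()) ; (_ , inj₂ (_ , ())) })
  ... | anti | _ = no (λ { (_ , inj₁ ()) ; (_ , inj₂ (() , _)) })

  record ChordlessPath (p : ℕ → Fin n) (m : ℕ) : Set where
    field
      distinct  : ∀ s t → s < t → t ≤ m → p s ≢ p t
      edge      : ∀ s → s < m → R (p s) (p (suc s))
      chordless : ∀ s t → suc s < t → t ≤ m → ¬ R (p s) (p t)

  module _ {p : ℕ → Fin n} {m : ℕ} (P : ChordlessPath p m) where
    open ChordlessPath P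

    private
      forward-adj : ∀ s t → s < t → t ≤ m → R (p s) (p t) ⟺ (t ≡ suc s ⊎ s ≡ suc t)
      forward-adj s t s<t t≤m with t ≟ℕ suc s
      ... | yes refl = (λ _ → inj₁ refl) , (λ _ → edge s t≤m)
      ... | no t≢1+s =
        (λ adj → ⊥-elim (chordless s t (≤∧≢⇒< s<t (t≢1+s ∘ sym)) t≤m adj)) ,
        (λ { (inj₁ t≡1+s) → ⊥-elim (t≢1+s t≡1+s)
           ; (inj₂ refl) → ⊥-elim (<-asym s<t (n<1+n t)) })

    path-adj : ∀ s t → s ≢ t → s ≤ m → t ≤ m → R (p s) (p t) ⟺ (t ≡ suc s ⊎ s ≡ suc t)
    path-adj s t s≢t s≤m t≤m with <-cmp s t
    ... | tri≈ _ s≡t _ = ⊥-elim (s≢t s≡t)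
    ... | tri< s<t _ _ = forward-adj s t s<t t≤m
    ... | tri> _ _ t<s = let (to , from) = forward-adj t s t<s s≤m in
                         (λ adj → swap (to (R-sym adj))) , (λ cons → R-sym (from (swap cons)))

    path-injective : ∀ s t → s ≤ m → t ≤ m → p s ≡ p t → s ≡ t
    path-injective s t s≤m t≤m ps≡pt with <-cmp s t
    ... | tri< s<t _ _ = ⊥-elim (distinct s t s<t t≤m ps≡pt)
    ... | tri≈ _ s≡t _ = s≡t
    ... | tri> _ _ t<s = ⊥-elim (distinct t s t<s s≤m (sym ps≡pt))

  path-prefix : ∀ {p m} k → k ≤ m → ChordlessPath p m → ChordlessPath p k
  path-prefix k k≤m P = record
    { distinct = λ s t s<t t≤k → distinct s t s<t (≤-trans t≤k k≤m)
    ; edge = λ s s<k → edge s (<-≤-trans s<k k≤m)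
    ; chordless = λ s t 1+s<t t≤k → chordless s t 1+s<t (≤-trans t≤k k≤m) }
    where open ChordlessPath P

  single : ∀ v → ChordlessPath (λ _ → v) 0
  single v = record
    { distinct = λ { s .0 s<0 z≤n → ⊥-elim (n≮0 s<0) }
    ; edge = λ s ()
    ; chordless = λ { s .0 1+s<0 z≤n → ⊥-elim (n≮0 1+s<0) } }

  extend : ∀ {p m v} → ChordlessPath p m → (∀ s → s ≤ m → p s ≢ v) →
           (∀ s → s ≤ m → R (p s) v ⟺ (s ≡ m)) → ChordlessPath (append p m v) (suc m)
  extend {p} {m} {v} P new attach = record { distinct = distinct′ ; edge = edge′ ; chordless = chordless′ }
    where
      open ChordlessPath P
      distinct′ : ∀ s t → s < t → t ≤ suc m → append p m v s ≢ append p m v t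
      distinct′ s t s<t t≤1+m with m≤n⇒m<n∨m≡n t≤1+m
      ... | inj₁ t<1+m = λ eq → distinct s t s<t (≤-pred t<1+m)
              (trans (sym (append-old s (≤-trans (<⇒≤ s<t) (≤-pred t<1+m))))
                     (trans eq (append-old t (≤-pred t<1+m))))
      ... | inj₂ refl = λ eq → new s (≤-pred s<t)
              (trans (sym (append-old s (≤-pred s<t))) (trans eq (append-new {p = p} {m} {v})))
      edge′ : ∀ s → s < suc m → R (append p m v s) (append p m v (suc s))
      edge′ s s<1+m with m≤n⇒m<n∨m≡n (≤-pred s<1+m)
      ... | inj₁ s<m = subst₂ R (sym (append-old s (<⇒≤ s<m))) (sym (append-old (suc s) s<m)) (edge s s<m)
      ... | inj₂ refl = subst₂ R (sym (append-old s ≤-refl)) (sym (append-new {p = p} {s} {v}))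
                          (proj₂ (attach s ≤-refl) refl)
      chordless′ : ∀ s t → suc s < t → t ≤ suc m → ¬ R (append p m v s) (append p m v t)
      chordless′ s t 1+s<t t≤1+m with m≤n⇒m<n∨m≡n t≤1+m
      ... | inj₁ t<1+m = λ adj → chordless s t 1+s<t (≤-pred t<1+m)
              (subst₂ R (append-old s (≤-trans (<⇒≤ (<-trans (n<1+n s) 1+s<t)) (≤-pred t<1+m)))
                        (append-old t (≤-pred t<1+m)) adj)
      ... | inj₂ refl = λ adj → <⇒≢ (≤-pred 1+s<t)
              (proj₁ (attach s (<⇒≤ (≤-pred 1+s<t)))
                 (subst₂ R (append-old s (<⇒≤ (≤-pred 1+s<t))) (append-new {p = p} {m} {v}) adj))

  -- This is the model of K4Model.
  record ISKConfig (q : ℕ → Fin n) (r u : ℕ) (y z₁ z₂ z₃ : Fin n) : Set where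
    field
      u≤r       : u ≤ r
      path      : ChordlessPath q r
      y-off     : ∀ s → s ≤ r → y ≢ q s
      z₁-off    : ∀ s → s ≤ r → z₁ ≢ q s
      z₂-off    : ∀ s → s ≤ r → z₂ ≢ q s
      z₃-off    : ∀ s → s ≤ r → z₃ ≢ q s
      y≢z₂      : y ≢ z₂
      z₁≢z₃     : z₁ ≢ z₃
      y-attach  : ∀ s → s ≤ r → R y (q s) ⟺ (s ≡ 0)
      z₁-attach : ∀ s → s ≤ r → R z₁ (q s) ⟺ (s ≡ r)
      z₂-attach : ∀ s → s ≤ r → ¬ R z₂ (q s)
      z₃-attach : ∀ s → s ≤ r → R z₃ (q s) ⟺ (s ≡ u)
      yz₁       : R y z₁
      yz₃       : R y z₃
      ¬yz₂      : ¬ R y z₂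
      z₁z₂      : R z₁ z₂
      z₂z₃      : R z₂ z₃
      ¬z₁z₃     : ¬ R z₁ z₃

  module ISKCopy {q r u y z₁ z₂ z₃} (H : ISKConfig q r u y z₁ z₂ z₃) where
    open ISKConfig H
    open K4Model r u u≤r

    interpret : ModelV → Fin n
    interpret KY = y
    interpret KZ1 = z₁
    interpret KZ2 = z₂
    interpret KZ3 = z₃
    interpret (KQ s) = q s

    interpret-injective : ∀ a b → Valid a → Valid b → interpret a ≡ interpret b → a ≡ b
    interpret-injective KY KY _ _ _ = refl
    interpret-injective KZ1 KZ1 _ _ _ = refl
    interpret-injective KZ2 KZ2 _ _ _ = refl
    interpret-injective KZ3 KZ3 _ _ _ = refl
    interpret-injective (KQ s) (KQ t) s≤r t≤r eq = cong KQ (path-injective path s t s≤r t≤r eq)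
    interpret-injective KY (KQ t) _ t≤r eq = ⊥-elim (y-off t t≤r eq)
    interpret-injective (KQ t) KY t≤r _ eq = ⊥-elim (y-off t t≤r (sym eq))
    interpret-injective KZ1 (KQ t) _ t≤r eq = ⊥-elim (z₁-off t t≤r eq)
    interpret-injective (KQ t) KZ1 t≤r _ eq = ⊥-elim (z₁-off t t≤r (sym eq))
    interpret-injective KZ2 (KQ t) _ t≤r eq = ⊥-elim (z₂-off t t≤r eq)
    interpret-injective (KQ t) KZ2 t≤r _ eq = ⊥-elim (z₂-off t t≤r (sym eq))
    interpret-injective KZ3 (KQ t) _ t≤r eq = ⊥-elim (z₃-off t t≤r eq)
    interpret-injective (KQ t) KZ3 t≤r _ eq = ⊥-elim (z₃-off t t≤r (sym eq))
    interpret-injective KY KZ1 _ _ eq = ⊥-elim (proj₁ yz₁ eq)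
    interpret-injective KZ1 KY _ _ eq = ⊥-elim (proj₁ yz₁ (sym eq))
    interpret-injective KY KZ2 _ _ eq = ⊥-elim (y≢z₂ eq)
    interpret-injective KZ2 KY _ _ eq = ⊥-elim (y≢z₂ (sym eq))
    interpret-injective KY KZ3 _ _ eq = ⊥-elim (proj₁ yz₃ eq)
    interpret-injective KZ3 KY _ _ eq = ⊥-elim (proj₁ yz₃ (sym eq))
    interpret-injective KZ1 KZ2 _ _ eq = ⊥-elim (proj₁ z₁z₂ eq)
    interpret-injective KZ2 KZ1 _ _ eq = ⊥-elim (proj₁ z₁z₂ (sym eq))
    interpret-injective KZ1 KZ3 _ _ eq = ⊥-elim (z₁≢z₃ eq)
    interpret-injective KZ3 KZ1 _ _ eq = ⊥-elim (z₁≢z₃ (sym eq))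
    interpret-injective KZ2 KZ3 _ _ eq = ⊥-elim (proj₁ z₂z₃ eq)
    interpret-injective KZ3 KZ2 _ _ eq = ⊥-elim (proj₁ z₂z₃ (sym eq))

    interpret-adj : ∀ a b → Valid a → Valid b → a ≢ b → R (interpret a) (interpret b) ⟺ ModelAdj r u a b
    interpret-adj (KQ s) (KQ t) s≤r t≤r a≢b = path-adj path s t (a≢b ∘ cong KQ) s≤r t≤r
    interpret-adj KY (KQ s) _ s≤r _ = y-attach s s≤r
    interpret-adj (KQ s) KY s≤r _ _ = R-flip (y-attach s s≤r)
    interpret-adj KZ1 (KQ s) _ s≤r _ = z₁-attach s s≤r
    interpret-adj (KQ s) KZ1 s≤r _ _ = R-flip (z₁-attach s s≤r)
    interpret-adj KZ2 (KQ s) _ s≤r _ = z₂-attach s s≤r , λ ()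
    interpret-adj (KQ s) KZ2 s≤r _ _ = z₂-attach s s≤r ∘ R-sym , λ ()
    interpret-adj KZ3 (KQ s) _ s≤r _ = z₃-attach s s≤r
    interpret-adj (KQ s) KZ3 s≤r _ _ = R-flip (z₃-attach s s≤r)
    interpret-adj KY KZ1 _ _ _ = (λ _ → tt) , (λ _ → yz₁)
    interpret-adj KZ1 KY _ _ _ = (λ _ → tt) , (λ _ → R-sym yz₁)
    interpret-adj KY KZ3 _ _ _ = (λ _ → tt) , (λ _ → yz₃)
    interpret-adj KZ3 KY _ _ _ = (λ _ → tt) , (λ _ → R-sym yz₃)
    interpret-adj KY KZ2 _ _ _ = ¬yz₂ , λ ()
    interpret-adj KZ2 KY _ _ _ = ¬yz₂ ∘ R-sym , λ ()
    interpret-adj KZ1 KZ2 _ _ _ = (λ _ → tt) , (λ _ → z₁z₂)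
    interpret-adj KZ2 KZ1 _ _ _ = (λ _ → tt) , (λ _ → R-sym z₁z₂)
    interpret-adj KZ2 KZ3 _ _ _ = (λ _ → tt) , (λ _ → z₂z₃)
    interpret-adj KZ3 KZ2 _ _ _ = (λ _ → tt) , (λ _ → R-sym z₂z₃)
    interpret-adj KZ1 KZ3 _ _ _ = ¬z₁z₃ , λ ()
    interpret-adj KZ3 KZ1 _ _ _ = ¬z₁z₃ ∘ R-sym , λ ()
    interpret-adj KY KY _ _ a≢b = ⊥-elim (a≢b refl)
    interpret-adj KZ1 KZ1 _ _ a≢b = ⊥-elim (a≢b refl)
    interpret-adj KZ2 KZ2 _ _ a≢b = ⊥-elim (a≢b refl)
    interpret-adj KZ3 KZ3 _ _ a≢b = ⊥-elim (a≢b refl)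

    copy : InducedCopy (SubK4V ℓ) (SubK4Adj ℓ) R
    copy = record
      { f = interpret ∘ kind
      ; inj = λ v w eq → kind-injective v w (interpret-injective _ _ (kind-valid v) (kind-valid w) eq)
      ; adj⇔ = λ v w v≢w →
          let (toModel , fromModel) = kind-adj v w v≢w
              (toModel′ , fromModel′) = interpret-adj (kind v) (kind w) (kind-valid v) (kind-valid w)
                                                      (v≢w ∘ kind-injective v w)
          in mk⇔ (fromModel′ ∘ toModel) (fromModel ∘ toModel′) }

  noISKConfig : ISK4WheelFree G → ∀ {q r u y z₁ z₂ z₃} → ¬ ISKConfig q r u y z₁ z₂ z₃
  noISKConfig free {r = r} {u = u} H =
    proj₁ (free S S-sym) (K4Model.ℓ r u (ISKConfig.u≤r H)) (ISKCopy.copy H)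

  -- A hole: the vertex y closes the path p 0 … p m into the induced cycle
  -- y – p 0 – … – p m – y, whose vertices are listed by `rim`.
  record Hole (y : Fin n) (p : ℕ → Fin n) (m : ℕ) : Set where
    field
      path     : ChordlessPath p m
      y-off    : ∀ s → s ≤ m → y ≢ p s
      y-attach : ∀ s → s ≤ m → R y (p s) ⟺ (s ≡ 0 ⊎ s ≡ m)

  rim : Fin n → (ℕ → Fin n) → ℕ → Fin n
  rim y p zero = y
  rim y p (suc s) = p s

  -- t follows s on the cycle 0 → 1 → … → k-1 → 0 (CycSucc of Defs).
  Follows : ℕ → ℕ → ℕ → Set
  Follows k s t = t ≡ suc s ⊎ (suc s ≡ k × t ≡ 0)

  module _ {y p m} (H : Hole y p m) where
    open Hole H

    rim-injective : ∀ s t → s ≤ suc m → t ≤ suc m → rim y p s ≡ rim y p t → s ≡ t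
    rim-injective zero zero _ _ _ = refl
    rim-injective zero (suc t) _ t≤ eq = ⊥-elim (y-off t (≤-pred t≤) eq)
    rim-injective (suc s) zero s≤ _ eq = ⊥-elim (y-off s (≤-pred s≤) (sym eq))
    rim-injective (suc s) (suc t) s≤ t≤ eq = cong suc (path-injective path s t (≤-pred s≤) (≤-pred t≤) eq)

    rim-adj : ∀ s t → s ≢ t → s ≤ suc m → t ≤ suc m →
              R (rim y p s) (rim y p t) ⟺ (Follows (suc (suc m)) s t ⊎ Follows (suc (suc m)) t s)
    rim-adj zero zero s≢t _ _ = ⊥-elim (s≢t refl)
    rim-adj zero (suc t) _ _ t≤ =
      (λ adj → [ (λ { refl → inj₁ (inj₁ refl) }) , (λ { refl → inj₂ (inj₂ (refl , refl)) }) ]′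
                 (proj₁ (y-attach t (≤-pred t≤)) adj)) ,
      (λ { (inj₁ (inj₁ eq)) → proj₂ (y-attach t (≤-pred t≤)) (inj₁ (suc-injective eq))
         ; (inj₁ (inj₂ (() , _)))
         ; (inj₂ (inj₁ ()))
         ; (inj₂ (inj₂ (eq , _))) → proj₂ (y-attach t (≤-pred t≤)) (inj₂ (suc-injective (suc-injective eq))) })
    rim-adj (suc s) zero s≢t s≤ t≤ =
      let (to , from) = rim-adj zero (suc s) (s≢t ∘ sym) t≤ s≤ in
      (λ adj → swap (to (R-sym adj))) , (λ cyc → R-sym (from (swap cyc)))
    rim-adj (suc s) (suc t) s≢t s≤ t≤ =
      let (to , from) = path-adj path s t (s≢t ∘ cong suc) (≤-pred s≤) (≤-pred t≤) in
      (λ adj → ⊎-map (inj₁ ∘ cong suc) (inj₁ ∘ cong suc) (to adj)) ,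
      (λ { (inj₁ (inj₁ eq)) → from (inj₁ (suc-injective eq))
         ; (inj₁ (inj₂ (_ , ())))
         ; (inj₂ (inj₁ eq)) → from (inj₂ (suc-injective eq))
         ; (inj₂ (inj₂ (_ , ()))) })

  noWheel : ISK4WheelFree G → ∀ {y p m c} → Hole y p m → c ≢ y → (∀ s → s ≤ m → c ≢ p s) →
            ∀ {s₁ s₂ s₃} → s₁ < s₂ → s₂ < s₃ → s₃ ≤ suc m →
            R c (rim y p s₁) → R c (rim y p s₂) → R c (rim y p s₃) → ⊥
  noWheel free {y} {p} {m} {c} H c≢y c-off-path {s₁} {s₂} {s₃} s₁<s₂ s₂<s₃ s₃≤ c₁ c₂ c₃ =
    proj₂ (free S S-sym) k spokes 3≤k 3≤∣spokes∣ copy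
    where
      k : ℕ
      k = suc (suc m)

      isSpoke : Fin k → Bool
      isSpoke i = does (R? c (rim y p (toℕ i)))

      spokes : Subset k
      spokes = tabulate isSpoke

      spokes-spec : ∀ i → i ∈ spokes ⟺ R c (rim y p (toℕ i))
      spokes-spec i =
        (λ i∈ → does⇒ (R? c (rim y p (toℕ i))) (trans (sym (lookup∘tabulate isSpoke i)) ([]=⇒lookup i∈))) ,
        (λ adj → lookup⇒[]= i spokes (trans (lookup∘tabulate isSpoke i) (dec-true (R? c (rim y p (toℕ i))) adj)))

      position : ∀ {s} → s ≤ suc m → Fin k
      position s≤ = fromℕ< (s≤s s≤)

      position-spoke : ∀ {s} (s≤ : s ≤ suc m) → R c (rim y p s) → position s≤ ∈ spokes
      position-spoke {s} s≤ adj =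
        proj₂ (spokes-spec (position s≤)) (subst (R c ∘ rim y p) (sym (toℕ-fromℕ< (s≤s s≤))) adj)

      position-distinct : ∀ {s t} (s≤ : s ≤ suc m) (t≤ : t ≤ suc m) → s < t → position s≤ ≢ position t≤
      position-distinct s≤ t≤ s<t eq =
        <⇒≢ s<t (trans (sym (toℕ-fromℕ< (s≤s s≤))) (trans (cong toℕ eq) (toℕ-fromℕ< (s≤s t≤))))

      s₁≤ : s₁ ≤ suc m
      s₁≤ = ≤-trans (<⇒≤ (<-trans s₁<s₂ s₂<s₃)) s₃≤
      s₂≤ : s₂ ≤ suc m
      s₂≤ = ≤-trans (<⇒≤ s₂<s₃) s₃≤

      3≤∣spokes∣ : 3 ≤ ∣ spokes ∣
      3≤∣spokes∣ = three⇒3≤∣p∣ (position-distinct s₁≤ s₂≤ s₁<s₂)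
                              (position-distinct s₁≤ s₃≤ (<-trans s₁<s₂ s₂<s₃))
                              (position-distinct s₂≤ s₃≤ s₂<s₃)
                              (position-spoke s₁≤ c₁) (position-spoke s₂≤ c₂) (position-spoke s₃≤ c₃)

      3≤k : 3 ≤ k
      3≤k = s≤s (≤-trans (≤-trans (s≤s (≤-trans (s≤s z≤n) s₁<s₂)) s₂<s₃) s₃≤)

      c-off : ∀ s → s ≤ suc m → c ≢ rim y p s
      c-off zero _ = c≢y
      c-off (suc s) s≤ = c-off-path s (≤-pred s≤)

      vertex : WheelV k → Fin n
      vertex (inj₁ i) = rim y p (toℕ i)
      vertex (inj₂ _) = c

      toℕ≤ : (i : Fin k) → toℕ i ≤ suc m
      toℕ≤ i = ≤-pred (toℕ<n i)

      vertex-injective : ∀ a b → vertex a ≡ vertex b → a ≡ b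
      vertex-injective (inj₁ i) (inj₁ j) eq =
        cong inj₁ (toℕ-injective (rim-injective H (toℕ i) (toℕ j) (toℕ≤ i) (toℕ≤ j) eq))
      vertex-injective (inj₁ i) (inj₂ _) eq = ⊥-elim (c-off (toℕ i) (toℕ≤ i) (sym eq))
      vertex-injective (inj₂ _) (inj₁ j) eq = ⊥-elim (c-off (toℕ j) (toℕ≤ j) eq)
      vertex-injective (inj₂ tt) (inj₂ tt) _ = refl

      vertex-adj : ∀ a b → a ≢ b → WheelAdj k spokes a b ⇔ R (vertex a) (vertex b)
      vertex-adj (inj₁ i) (inj₁ j) i≢j =
        let (to , from) = rim-adj H (toℕ i) (toℕ j) (i≢j ∘ cong inj₁ ∘ toℕ-injective) (toℕ≤ i) (toℕ≤ j) in
        mk⇔ from to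
      vertex-adj (inj₁ i) (inj₂ _) _ = mk⇔ (R-sym ∘ proj₁ (spokes-spec i)) (proj₂ (spokes-spec i) ∘ R-sym)
      vertex-adj (inj₂ _) (inj₁ j) _ = mk⇔ (proj₁ (spokes-spec j)) (proj₂ (spokes-spec j))
      vertex-adj (inj₂ tt) (inj₂ tt) a≢b = ⊥-elim (a≢b refl)

      copy : InducedCopy (WheelV k) (WheelAdj k spokes) R
      copy = record { f = vertex ; inj = vertex-injective ; adj⇔ = vertex-adj }

  closeHole : ∀ {p m y z} → ChordlessPath p m → (∀ s → s ≤ m → y ≢ p s) → (∀ s → s ≤ m → z ≢ p s) →
              (∀ s → s ≤ m → R y (p s) ⟺ (s ≡ 0)) → (∀ s → s ≤ m → R z (p s) ⟺ (s ≡ m)) → R y z →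
              Hole y (append p m z) (suc m)
  closeHole {p} {m} {y} {z} P y-off z-off y-attach z-attach yz = record
    { path = extend P (λ s s≤m → z-off s s≤m ∘ sym) (λ s s≤m → R-flip (z-attach s s≤m))
    ; y-off = onAppend (λ _ v → y ≢ v) y-off (proj₁ yz)
    ; y-attach = onAppend (λ s v → R y v ⟺ (s ≡ 0 ⊎ s ≡ suc m))
        (λ s s≤m → let (to , from) = y-attach s s≤m in
                   inj₁ ∘ to , [ from , (λ { refl → ⊥-elim (<-irrefl refl s≤m) }) ]′)
        ((λ _ → inj₂ refl) , (λ _ → yz)) }

  edgePath : ∀ {a b} → R a b → ChordlessPath (append (λ _ → a) 0 b) 1
  edgePath {a} {b} ab = extend (single a) (λ { .0 z≤n → proj₁ ab })
                               (λ { .0 z≤n → (λ _ → refl) , (λ _ → ab) })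

  threePath : ∀ {a b c} → R a b → R b c → a ≢ c → ¬ R a c →
              ChordlessPath (append (append (λ _ → a) 0 b) 1 c) 2
  threePath ab bc a≢c ¬ac =
    extend (edgePath ab) (at≤1 a≢c (proj₁ bc))
           (at≤1 ((λ ac → ⊥-elim (¬ac ac)) , λ ()) ((λ _ → refl) , (λ _ → bc)))

module Bipartition {n} {G : Trigraph n} {X A B : Subset n} (bip : IsBipartition G X A B) where
  covers : ∀ v → v ∈ X → v ∈ A ⊎ v ∈ B
  covers = proj₁ bip

  A⊆X : ∀ {v} → v ∈ A → v ∈ X
  A⊆X = proj₁ (proj₂ bip) _

  B⊆X : ∀ {v} → v ∈ B → v ∈ X
  B⊆X = proj₁ (proj₂ (proj₂ bip)) _

  A≢B : ∀ {a b} → a ∈ A → b ∈ B → a ≢ b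
  A≢B a∈A b∈B refl = proj₁ (proj₂ (proj₂ (proj₂ bip))) _ a∈A b∈B

  A-stable : ∀ {u v} → u ∈ A → v ∈ A → u ≢ v → θ G u v ≡ anti
  A-stable = proj₁ (proj₂ (proj₂ (proj₂ (proj₂ bip)))) _ _

  B-stable : ∀ {u v} → u ∈ B → v ∈ B → u ≢ v → θ G u v ≡ anti
  B-stable = proj₁ (proj₂ (proj₂ (proj₂ (proj₂ (proj₂ bip))))) _ _

  complete : ∀ {u v} → u ∈ A → v ∈ B → θ G u v ≡ strong
  complete = proj₂ (proj₂ (proj₂ (proj₂ (proj₂ (proj₂ bip))))) _ _

  ¬RAA : ∀ S {a a'} → a ∈ A → a' ∈ A → a ≢ a' → ¬ RealAdj G S a a'
  ¬RAA S a∈A a'∈A a≢a' = anti⇒¬realAdj G {S = S} (A-stable a∈A a'∈A a≢a')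

  ¬RBB : ∀ S {b b'} → b ∈ B → b' ∈ B → b ≢ b' → ¬ RealAdj G S b b'
  ¬RBB S b∈B b'∈B b≢b' = anti⇒¬realAdj G {S = S} (B-stable b∈B b'∈B b≢b')

  RAB : ∀ S {a b} → a ∈ A → b ∈ B → RealAdj G S a b
  RAB S a∈A b∈B = strong⇒realAdj G {S = S} (A≢B a∈A b∈B) (complete a∈A b∈B)

  RBA : ∀ S {b a} → b ∈ B → a ∈ A → RealAdj G S b a
  RBA S {b} {a} b∈B a∈A =
    strong⇒realAdj G {S = S} (A≢B a∈A b∈B ∘ sym) (trans (θ-sym G b a) (complete a∈A b∈B))

swapBipartition : ∀ {n} {G : Trigraph n} {X A B} → IsBipartition G X A B → IsBipartition G X B A
swapBipartition {G = G} (covers , A⊆X , B⊆X , disjoint , A-stable , B-stable , complete) =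
  (λ v v∈X → swap (covers v v∈X)) , B⊆X , A⊆X , (λ v v∈B v∈A → disjoint v v∈A v∈B) ,
  B-stable , A-stable , (λ u v u∈B v∈A → trans (θ-sym G u v) (complete v u v∈A u∈B))

-- Two bipartitions of the same complete bipartite trigraph whose first
-- sides meet are the same bipartition (up to inclusion, which suffices).
sameSides : ∀ {n} {G : Trigraph n} {X A B A' B'} → IsBipartition G X A B → IsBipartition G X A' B' →
            ∀ {a} → a ∈ A' → a ∈ A → (A' ⊆ A) × (B' ⊆ B)
sameSides {G = G} {X} {A} {B} {A'} {B'} bip bip' {a} a∈A' a∈A = A'⊆A , B'⊆B
  where
    module P = Bipartition {G = G} {X} {A} {B} bip
    module P' = Bipartition {G = G} {X} {A'} {B'} bip'
    A'⊆A : A' ⊆ A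
    A'⊆A {v} v∈A' with P.covers v (P'.A⊆X v∈A')
    ... | inj₁ v∈A = v∈A
    ... | inj₂ v∈B = ⊥-elim (P'.¬RAA full a∈A' v∈A' (P.A≢B a∈A v∈B) (P.RAB full a∈A v∈B))
    B'⊆B : B' ⊆ B
    B'⊆B {v} v∈B' with P.covers v (P'.B⊆X v∈B')
    ... | inj₂ v∈B = v∈B
    ... | inj₁ v∈A = ⊥-elim (P.¬RAA full a∈A v∈A (P'.A≢B a∈A' v∈B') (P'.RAB full a∈A' v∈B'))

bipartition-thick : ∀ {n} {G : Trigraph n} {X A B} → IsThickCompleteBipartite G X →
                    IsBipartition G X A B → 3 ≤ ∣ A ∣ × 3 ≤ ∣ B ∣
bipartition-thick {G = G} {X} {A} {B} (A' , B' , bip' , 3≤A' , 3≤B') bip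
  with member A' (≤-trans (s≤s z≤n) 3≤A')
... | a , a∈A' with Bipartition.covers {G = G} {X} {A} {B} bip a (Bipartition.A⊆X {G = G} {X} {A'} {B'} bip' a∈A')
...   | inj₁ a∈A = let (A'⊆A , B'⊆B) = sameSides {G = G} {X} {A} {B} {A'} {B'} bip bip' a∈A' a∈A in
                   ≤-trans 3≤A' (p⊆q⇒∣p∣≤∣q∣ A'⊆A) , ≤-trans 3≤B' (p⊆q⇒∣p∣≤∣q∣ B'⊆B)
...   | inj₂ a∈B = let (A'⊆B , B'⊆A) = sameSides {G = G} {X} {B} {A} {A'} {B'} (swapBipartition {G = G} {X} {A} {B} bip) bip' a∈A' a∈B in
                   ≤-trans 3≤B' (p⊆q⇒∣p∣≤∣q∣ B'⊆A) , ≤-trans 3≤A' (p⊆q⇒∣p∣≤∣q∣ A'⊆B)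

-- The setting of the theorem: a maximal thick complete bipartite X and
-- a component C of G ∖ X.  Unless stated otherwise we work in the full
-- realization, where adjacency is adjacency of G.

module Setting {n} (G : Trigraph n) (free : ISK4WheelFree G) (X : Subset n) (maxX : IsMaximalThickCB G X)
               (C : Subset n) (comp : IsComponentOfMinus G X C) where

  open Realization G full full-sym

  adjacent⇒R : ∀ {u v} → Adjacent G u v → R u v
  adjacent⇒R adj = adjacent⇒realAdj G adj refl

  R⇒adjacent : ∀ {u v} → R u v → Adjacent G u v
  R⇒adjacent = realAdj⇒adjacent G

  C∩X=∅ : ∀ {c} → c ∈ C → c ∉ X
  C∩X=∅ c∈C = x∈∁p⇒x∉p (proj₁ comp c∈C)

  C≢X : ∀ {c v} → c ∈ C → v ∈ X → c ≢ v
  C≢X c∈C v∈X refl = C∩X=∅ c∈C v∈X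

  C-connected : Connected G C
  C-connected = proj₁ (proj₂ (proj₂ comp))

  module OneSide (A B : Subset n) (bip : IsBipartition G X A B) (3≤∣A∣ : 3 ≤ ∣ A ∣) (3≤∣B∣ : 3 ≤ ∣ B ∣) where
    open Bipartition {G = G} {X} {A} {B} bip public

    X≢C : ∀ {c v} → c ∈ C → v ∈ X → v ≢ c
    X≢C c∈C v∈X = C≢X c∈C v∈X ∘ sym

    -- A vertex of C adjacent to two vertices of A and to one of B is the
    -- centre of a wheel (whose rim is a square of X, or passes through it).
    noNeighbourInB : ∀ {x a₁ a₂} → x ∈ C → a₁ ∈ A → a₂ ∈ A → a₁ ≢ a₂ →
                     Adjacent G x a₁ → Adjacent G x a₂ → ∀ b → b ∈ B → ¬ Adjacent G x b
    noNeighbourInB {x} {a₁} {a₂} x∈C a₁∈A a₂∈A a₁≢a₂ xa₁ xa₂ b b∈B xb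
      with avoidTwo B 3≤∣B∣ b b
    ... | b' , b'∈B , b'≢b , _ with adjacent? G x b'
    ...   | yes xb' =
      -- rim a₁ – b – a₂ – b' – a₁, centre x adjacent to a₁ , b , a₂
      noWheel free hole (X≢C x∈C (A⊆X a₁∈A) ∘ sym) (at≤2 (C≢X x∈C (B⊆X b∈B)) (C≢X x∈C (A⊆X a₂∈A)) (C≢X x∈C (B⊆X b'∈B)))
              {0} {1} {2} (s≤s z≤n) (s≤s (s≤s z≤n)) (s≤s (s≤s z≤n))
              (adjacent⇒R xa₁) (adjacent⇒R xb) (adjacent⇒R xa₂)
      where
        hole : Hole a₁ (append (append (λ _ → b) 0 a₂) 1 b') 2
        hole = record
          { path = threePath (RBA full b∈B a₂∈A) (RAB full a₂∈A b'∈B) (b'≢b ∘ sym) (¬RBB full b∈B b'∈B (b'≢b ∘ sym))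
          ; y-off = at≤2 (A≢B a₁∈A b∈B) a₁≢a₂ (A≢B a₁∈A b'∈B)
          ; y-attach = at≤2 ((λ _ → inj₁ refl) , (λ _ → RAB full a₁∈A b∈B))
                            ((λ a₁a₂ → ⊥-elim (¬RAA full a₁∈A a₂∈A a₁≢a₂ a₁a₂)) , (λ { (inj₁ ()) ; (inj₂ ()) }))
                            ((λ _ → inj₂ refl) , (λ _ → RAB full a₁∈A b'∈B)) }
    ...   | no ¬xb' =
      -- rim x – a₁ – b' – a₂ – x, centre b adjacent to x , a₁ , a₂
      noWheel free hole (C≢X x∈C (B⊆X b∈B) ∘ sym) (at≤2 (A≢B a₁∈A b∈B ∘ sym) (b'≢b ∘ sym) (A≢B a₂∈A b∈B ∘ sym))
              {0} {1} {3} (s≤s z≤n) (s≤s (s≤s z≤n)) ≤-refl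
              (R-sym (adjacent⇒R xb)) (RBA full b∈B a₁∈A) (RBA full b∈B a₂∈A)
      where
        hole : Hole x (append (append (λ _ → a₁) 0 b') 1 a₂) 2
        hole = record
          { path = threePath (RAB full a₁∈A b'∈B) (RBA full b'∈B a₂∈A) a₁≢a₂ (¬RAA full a₁∈A a₂∈A a₁≢a₂)
          ; y-off = at≤2 (C≢X x∈C (A⊆X a₁∈A)) (C≢X x∈C (B⊆X b'∈B)) (C≢X x∈C (A⊆X a₂∈A))
          ; y-attach = at≤2 ((λ _ → inj₁ refl) , (λ _ → adjacent⇒R xa₁))
                            ((λ xb'R → ⊥-elim (¬xb' (R⇒adjacent xb'R))) , (λ { (inj₁ ()) ; (inj₂ ()) }))
                            ((λ _ → inj₂ refl) , (λ _ → adjacent⇒R xa₂)) }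

    -- In any realization, a vertex of C adjacent to c₁ , c₂ ∈ A but not to
    -- c₃ ∈ A, and to no vertex of B, yields an ISK4: with b₁ , b₂ ∈ B the
    -- branch vertices c₁ , c₂ , b₁ , b₂ are joined through x and c₃.
    noFan : ∀ (S : Fin n → Fin n → Bool) (S-sym : SymChoice n S) {x c₁ c₂ c₃} → x ∈ C →
            c₁ ∈ A → c₂ ∈ A → c₃ ∈ A → c₁ ≢ c₂ → c₁ ≢ c₃ → c₂ ≢ c₃ →
            RealAdj G S x c₁ → RealAdj G S x c₂ → ¬ RealAdj G S x c₃ →
            (∀ b → b ∈ B → ¬ RealAdj G S x b) → ⊥
    noFan S S-sym {x} {c₁} {c₂} {c₃} x∈C c₁∈A c₂∈A c₃∈A c₁≢c₂ c₁≢c₃ c₂≢c₃ xc₁ xc₂ ¬xc₃ ¬xB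
      with avoidTwo B 3≤∣B∣ x x
    ... | b₁ , b₁∈B , _ with avoidTwo B 3≤∣B∣ b₁ b₁
    ...   | b₂ , b₂∈B , b₂≢b₁ , _ = RS.noISKConfig free config
      where
        module RS = Realization G S S-sym
        config : RS.ISKConfig (append (λ _ → x) 0 c₂) 1 1 c₁ b₁ c₃ b₂
        config = record
          { u≤r = ≤-refl
          ; path = RS.edgePath xc₂
          ; y-off = at≤1 (X≢C x∈C (A⊆X c₁∈A)) c₁≢c₂
          ; z₁-off = at≤1 (X≢C x∈C (B⊆X b₁∈B)) (A≢B c₂∈A b₁∈B ∘ sym)
          ; z₂-off = at≤1 (X≢C x∈C (A⊆X c₃∈A)) (c₂≢c₃ ∘ sym)
          ; z₃-off = at≤1 (X≢C x∈C (B⊆X b₂∈B)) (A≢B c₂∈A b₂∈B ∘ sym)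
          ; y≢z₂ = c₁≢c₃
          ; z₁≢z₃ = b₂≢b₁ ∘ sym
          ; y-attach = at≤1 ((λ _ → refl) , (λ _ → RS.R-sym xc₁))
                            ((λ c₁c₂ → ⊥-elim (¬RAA S c₁∈A c₂∈A c₁≢c₂ c₁c₂)) , λ ())
          ; z₁-attach = at≤1 ((λ b₁x → ⊥-elim (¬xB b₁ b₁∈B (RS.R-sym b₁x))) , λ ())
                             ((λ _ → refl) , (λ _ → RBA S b₁∈B c₂∈A))
          ; z₂-attach = at≤1 (¬xc₃ ∘ RS.R-sym) (¬RAA S c₃∈A c₂∈A (c₂≢c₃ ∘ sym))
          ; z₃-attach = at≤1 ((λ b₂x → ⊥-elim (¬xB b₂ b₂∈B (RS.R-sym b₂x))) , λ ())
                             ((λ _ → refl) , (λ _ → RBA S b₂∈B c₂∈A))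
          ; yz₁ = RAB S c₁∈A b₁∈B
          ; yz₃ = RAB S c₁∈A b₂∈B
          ; ¬yz₂ = ¬RAA S c₁∈A c₃∈A c₁≢c₃
          ; z₁z₂ = RBA S b₁∈B c₃∈A
          ; z₂z₃ = RAB S c₃∈A b₂∈B
          ; ¬z₁z₃ = ¬RBB S b₁∈B b₂∈B (b₂≢b₁ ∘ sym) }

    -- A vertex of C strongly complete to A and strongly anticomplete to B
    -- could be added to B, contradicting the maximality of X.
    noExtension : ∀ {x} → x ∈ C → (∀ a → a ∈ A → θ G x a ≡ strong) → (∀ b → b ∈ B → θ G x b ≡ anti) → ⊥
    noExtension {x} x∈C x-A x-B =
      C∩X=∅ x∈C (proj₂ maxX Y (p⊆p∪q ⁅ x ⁆) (A , B+x , bipY , 3≤∣A∣ , ≤-trans 3≤∣B∣ (∣p∣≤∣p∪q∣ B ⁅ x ⁆)) x∈Y)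
      where
        Y = X ∪ ⁅ x ⁆
        B+x = B ∪ ⁅ x ⁆
        x∈Y : x ∈ Y
        x∈Y = x∈p∪q⁺ {p = X} (inj₂ (x∈⁅x⁆ x))
        x∈B+x : x ∈ B+x
        x∈B+x = x∈p∪q⁺ {p = B} (inj₂ (x∈⁅x⁆ x))
        inY : ∀ {v} → v ∈ Y → v ∈ X ⊎ v ≡ x
        inY v∈Y = ⊎-map (λ v∈X → v∈X) (x∈⁅y⁆⇒x≡y x) (x∈p∪q⁻ X ⁅ x ⁆ v∈Y)
        inB+x : ∀ {v} → v ∈ B+x → v ∈ B ⊎ v ≡ x
        inB+x v∈B+x = ⊎-map (λ v∈B → v∈B) (x∈⁅y⁆⇒x≡y x) (x∈p∪q⁻ B ⁅ x ⁆ v∈B+x)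
        bipY : IsBipartition G Y A B+x
        bipY = (λ v v∈Y → [ (λ v∈X → ⊎-map (λ v∈A → v∈A) (λ v∈B → x∈p∪q⁺ (inj₁ v∈B)) (covers v v∈X)) ,
                            (λ { refl → inj₂ x∈B+x }) ]′ (inY v∈Y))
             , (λ v v∈A → x∈p∪q⁺ (inj₁ (A⊆X v∈A)))
             , (λ v v∈B+x → [ (λ v∈B → x∈p∪q⁺ (inj₁ (B⊆X v∈B))) , (λ { refl → x∈Y }) ]′ (inB+x v∈B+x))
             , (λ v v∈A v∈B+x → [ (λ v∈B → A≢B v∈A v∈B refl) , (λ { refl → C∩X=∅ x∈C (A⊆X v∈A) }) ]′ (inB+x v∈B+x))
             , (λ u v u∈A v∈A u≢v → A-stable u∈A v∈A u≢v)
             , (λ u v u∈B+x v∈B+x u≢v →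
                  [ (λ u∈B → [ (λ v∈B → B-stable u∈B v∈B u≢v)
                             , (λ { refl → trans (θ-sym G u x) (x-B u u∈B) }) ]′ (inB+x v∈B+x))
                  , (λ { refl → [ (λ v∈B → x-B v v∈B) , (λ { refl → ⊥-elim (u≢v refl) }) ]′ (inB+x v∈B+x) }) ]′
                  (inB+x u∈B+x))
             , (λ u v u∈A v∈B+x → [ (λ v∈B → complete u∈A v∈B)
                                  , (λ { refl → trans (θ-sym G u x) (x-A u u∈A) }) ]′ (inB+x v∈B+x))

    -- A vertex of C with two neighbours in A but none in B is impossible:
    -- with a third a₃ ∈ A, either x misses a₃ (an ISK4 by noFan), or x sees
    -- a₃ and then some a₀ ∈ A is not strongly adjacent to x (by noExtension),
    -- and the realization dropping x a₀ gives an ISK4 by noFan.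
    noTwoNeighboursInA : ∀ {x a₁ a₂} → x ∈ C → a₁ ∈ A → a₂ ∈ A → a₁ ≢ a₂ →
                         Adjacent G x a₁ → Adjacent G x a₂ → (∀ b → b ∈ B → ¬ Adjacent G x b) → ⊥
    noTwoNeighboursInA {x} {a₁} {a₂} x∈C a₁∈A a₂∈A a₁≢a₂ xa₁ xa₂ ¬xB with avoidTwo A 3≤∣A∣ a₁ a₂
    ... | a₃ , a₃∈A , a₃≢a₁ , a₃≢a₂ with adjacent? G x a₃
    ...   | no ¬xa₃ = noFan full full-sym x∈C a₁∈A a₂∈A a₃∈A a₁≢a₂ (a₃≢a₁ ∘ sym) (a₃≢a₂ ∘ sym)
                        (adjacent⇒R xa₁) (adjacent⇒R xa₂) (¬xa₃ ∘ R⇒adjacent) (λ b b∈B → ¬xB b b∈B ∘ R⇒adjacent)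
    ...   | yes xa₃ with any? (λ a → a ∈? A ×-dec ¬? (θ G x a ≟T strong))
    ...     | no allStrong = noExtension x∈C x-A x-B
      where
        x-A : ∀ a → a ∈ A → θ G x a ≡ strong
        x-A a a∈A with θ G x a ≟T strong
        ... | yes isStrong = isStrong
        ... | no ¬strong = ⊥-elim (allStrong (a , a∈A , ¬strong))
        x-B : ∀ b → b ∈ B → θ G x b ≡ anti
        x-B b b∈B with θ G x b ≟T anti
        ... | yes isAnti = isAnti
        ... | no ¬anti = ⊥-elim (¬xB b b∈B (C≢X x∈C (B⊆X b∈B) , ¬anti))
    ...     | yes (a₀ , a₀∈A , ¬strong) = dropping
      where
        S′ = allBut x a₀
        R′ : ∀ {c} → c ∈ A → c ≢ a₀ → Adjacent G x c → RealAdj G S′ x c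
        R′ c∈A c≢a₀ xc = adjacent⇒realAdj G {S = S′} xc (allBut-other c≢a₀ (X≢C x∈C (A⊆X c∈A)))
        ¬R′a₀ : ¬ RealAdj G S′ x a₀
        ¬R′a₀ (_ , inj₁ isStrong) = ¬strong isStrong
        ¬R′a₀ (_ , inj₂ (_ , chosen)) with trans (sym chosen) (allBut-pair x a₀)
        ... | ()
        ¬R′B : ∀ b → b ∈ B → ¬ RealAdj G S′ x b
        ¬R′B b b∈B = ¬xB b b∈B ∘ realAdj⇒adjacent G {S = S′}
        dropping : ⊥
        dropping with a₀ ≟F a₁
        ... | yes refl = noFan S′ (allBut-sym x a₀) x∈C a₂∈A a₃∈A a₀∈A (a₃≢a₂ ∘ sym) (a₁≢a₂ ∘ sym) a₃≢a₁
                           (R′ a₂∈A (a₁≢a₂ ∘ sym) xa₂) (R′ a₃∈A a₃≢a₁ xa₃) ¬R′a₀ ¬R′B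
        ... | no a₀≢a₁ with a₀ ≟F a₂
        ...   | yes refl = noFan S′ (allBut-sym x a₀) x∈C a₁∈A a₃∈A a₀∈A (a₃≢a₁ ∘ sym) a₁≢a₂ a₃≢a₂
                             (R′ a₁∈A (a₀≢a₁ ∘ sym) xa₁) (R′ a₃∈A a₃≢a₂ xa₃) ¬R′a₀ ¬R′B
        ...   | no a₀≢a₂ = noFan S′ (allBut-sym x a₀) x∈C a₁∈A a₂∈A a₀∈A a₁≢a₂ (a₀≢a₁ ∘ sym) (a₀≢a₂ ∘ sym)
                             (R′ a₁∈A (a₀≢a₁ ∘ sym) xa₁) (R′ a₂∈A (a₀≢a₂ ∘ sym) xa₂) ¬R′a₀ ¬R′B

    oneNeighbourInA : ∀ {x a₁ a₂} → x ∈ C → a₁ ∈ A → a₂ ∈ A → Adjacent G x a₁ → Adjacent G x a₂ → a₁ ≡ a₂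
    oneNeighbourInA {x} {a₁} {a₂} x∈C a₁∈A a₂∈A xa₁ xa₂ with a₁ ≟F a₂
    ... | yes a₁≡a₂ = a₁≡a₂
    ... | no a₁≢a₂ = ⊥-elim (noTwoNeighboursInA x∈C a₁∈A a₂∈A a₁≢a₂ xa₁ xa₂
                               (noNeighbourInB x∈C a₁∈A a₂∈A a₁≢a₂ xa₁ xa₂))

  record Walk (w : ℕ → Fin n) (m : ℕ) : Set where
    field
      inC  : ∀ t → t ≤ m → w t ∈ C
      step : ∀ t → t < m → Adjacent G (w t) (w (suc t))

  walk-prefix : ∀ {w m} k → k ≤ m → Walk w m → Walk w k
  walk-prefix k k≤m W = record
    { inC = λ t t≤k → Walk.inC W t (≤-trans t≤k k≤m)
    ; step = λ t t<k → Walk.step W t (<-≤-trans t<k k≤m) }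

  walk-suffix : ∀ {w m} k → k ≤ m → Walk w m → Walk (λ s → w (s + k)) (m ∸ k)
  walk-suffix {w} {m} k k≤m W = record
    { inC = λ s s≤ → Walk.inC W (s + k) (subst (s + k ≤_) (m∸n+n≡m k≤m) (+-monoˡ-≤ k s≤))
    ; step = λ s s< → Walk.step W (s + k) (subst (suc s + k ≤_) (m∸n+n≡m k≤m) (+-monoˡ-≤ k s<)) }

  walkFromStar : ∀ {u v} → u ∈ C → Star (AdjIn G C) u v → ∃[ m ] ∃[ w ] (Walk w m × w 0 ≡ u × w m ≡ v)
  walkFromStar {u} u∈C ε = 0 , (λ _ → u) , record { inC = λ _ _ → u∈C ; step = λ _ () } , refl , refl
  walkFromStar {u} u∈C (uu' ◅ rest) with walkFromStar (proj₁ (proj₂ uu')) rest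
  ... | m , w , W , w₀≡u' , wₘ≡v = suc m , u∷w , record { inC = inC′ ; step = step′ } , refl , wₘ≡v
    where
      u∷w : ℕ → Fin n
      u∷w zero = u
      u∷w (suc s) = w s
      inC′ : ∀ t → t ≤ suc m → u∷w t ∈ C
      inC′ zero _ = u∈C
      inC′ (suc t) t≤ = Walk.inC W t (≤-pred t≤)
      step′ : ∀ t → t < suc m → Adjacent G (u∷w t) (u∷w (suc t))
      step′ zero _ = subst (Adjacent G u) (sym w₀≡u') (proj₂ (proj₂ uu'))
      step′ (suc t) t< = Walk.step W t (≤-pred t<)

  -- Cutting out w (i+1) … w (i+d) from a walk, provided w i is adjacent to
  -- w (i+1+d), gives a shorter walk with the same ends.
  module Shortcut {w m} (W : Walk w m) (i d : ℕ) (i+d≤m : i + d ≤ m) where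
    w′ : ℕ → Fin n
    w′ s with s ≤? i
    ... | yes _ = w s
    ... | no _ = w (s + d)

    m′ : ℕ
    m′ = m ∸ d

    private
      before : ∀ s → s ≤ i → w′ s ≡ w s
      before s s≤i with s ≤? i
      ... | yes _ = refl
      ... | no s≰i = ⊥-elim (s≰i s≤i)

      i≤m′ : i ≤ m′
      i≤m′ = m+n≤o⇒m≤o∸n i i+d≤m

    d≤m : d ≤ m
    d≤m = m+n≤o⇒n≤o i i+d≤m

    walk : (i < m′ → Adjacent G (w i) (w (suc i + d))) → Walk w′ m′
    walk jump = record { inC = inC′ ; step = step′ }
      where
        inC′ : ∀ s → s ≤ m′ → w′ s ∈ C
        inC′ s s≤ with s ≤? i
        ... | yes s≤i = Walk.inC W s (≤-trans s≤i (≤-trans i≤m′ (m∸n≤m m d)))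
        ... | no _ = Walk.inC W (s + d) (m≤o∸n⇒m+n≤o s d≤m s≤)
        step′ : ∀ s → s < m′ → Adjacent G (w′ s) (w′ (suc s))
        step′ s s< with s ≤? i | suc s ≤? i
        ... | yes _ | yes 1+s≤i = Walk.step W s (≤-trans 1+s≤i (≤-trans i≤m′ (m∸n≤m m d)))
        ... | yes s≤i | no 1+s≰i =
          let s≡i = ≤-antisym s≤i (≤-pred (≰⇒> 1+s≰i)) in
          subst (λ t → Adjacent G (w t) (w (suc t + d))) (sym s≡i) (jump (subst (_< m′) s≡i s<))
        ... | no s≰i | yes 1+s≤i = ⊥-elim (s≰i (≤-trans (n≤1+n s) 1+s≤i))
        ... | no _ | no _ = Walk.step W (s + d) (m≤o∸n⇒m+n≤o (suc s) d≤m s<)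

    start : w′ 0 ≡ w 0
    start = before 0 z≤n

    end : (m′ ≡ i → w i ≡ w m) → w′ m′ ≡ w m
    end last with m′ ≤? i
    ... | yes m′≤i = let m′≡i = ≤-antisym m′≤i i≤m′ in subst (λ t → w t ≡ w m) (sym m′≡i) (last m′≡i)
    ... | no _ = cong w (m∸n+n≡m d≤m)

    shorter : 1 ≤ d → m′ < m
    shorter 1≤d = ∸-monoʳ-< {m} {d} {0} 1≤d d≤m

  module Attachment (A B : Subset n) (bip : IsBipartition G X A B) (3≤∣A∣ : 3 ≤ ∣ A ∣) (3≤∣B∣ : 3 ≤ ∣ B ∣) where
    open OneSide A B bip 3≤∣A∣ 3≤∣B∣
    module Other = OneSide B A (swapBipartition {G = G} {X} {A} {B} bip) 3≤∣B∣ 3≤∣A∣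

    module CleanPath {w m α β} (W : Walk w m) (α∈A : α ∈ A) (β∈A : β ∈ A) (α≢β : α ≢ β)
       (αw₀ : Adjacent G α (w 0)) (βwₘ : Adjacent G β (w m))
       (interior-A : ∀ t → 0 < t → t < m → ∀ γ → γ ∈ A → ¬ Adjacent G γ (w t))
       (induced : ∀ i j → suc i < j → j ≤ m → w i ≢ w j × ¬ Adjacent G (w i) (w j)) where
      open Walk W

      -- By oneNeighbourInA, the only A-neighbours of the path are α at w 0
      -- and β at w m.
      A-attach : ∀ s → s ≤ m → ∀ γ → γ ∈ A → Adjacent G γ (w s) → (s ≡ 0 × γ ≡ α) ⊎ (s ≡ m × γ ≡ β)
      A-attach zero _ γ γ∈A γw₀ =
        inj₁ (refl , oneNeighbourInA (inC 0 z≤n) γ∈A α∈A (adjacent-sym G γw₀) (adjacent-sym G αw₀))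
      A-attach (suc s) s< γ γ∈A γw with m≤n⇒m<n∨m≡n s<
      ... | inj₁ s<m = ⊥-elim (interior-A (suc s) (s≤s z≤n) s<m γ γ∈A γw)
      ... | inj₂ refl = inj₂ (refl , oneNeighbourInA (inC (suc s) ≤-refl) γ∈A β∈A (adjacent-sym G γw) (adjacent-sym G βwₘ))

      α-attach : ∀ s → s ≤ m → R α (w s) ⟺ (s ≡ 0)
      α-attach s s≤m =
        (λ αw → [ proj₁ , (λ { (_ , α≡β) → ⊥-elim (α≢β α≡β) }) ]′ (A-attach s s≤m α α∈A (R⇒adjacent αw))) ,
        (λ { refl → adjacent⇒R αw₀ })

      β-attach : ∀ s → s ≤ m → Adjacent G β (w s) → s ≡ m
      β-attach s s≤m βw = [ (λ { (_ , β≡α) → ⊥-elim (α≢β (sym β≡α)) }) , proj₁ ]′ (A-attach s s≤m β β∈A βw)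

      a₃ : Fin n
      a₃ = proj₁ (avoidTwo A 3≤∣A∣ α β)
      a₃∈A : a₃ ∈ A
      a₃∈A = proj₁ (proj₂ (avoidTwo A 3≤∣A∣ α β))
      a₃≢α : a₃ ≢ α
      a₃≢α = proj₁ (proj₂ (proj₂ (avoidTwo A 3≤∣A∣ α β)))
      a₃≢β : a₃ ≢ β
      a₃≢β = proj₂ (proj₂ (proj₂ (avoidTwo A 3≤∣A∣ α β)))

      a₃-off : ∀ s → s ≤ m → ¬ R a₃ (w s)
      a₃-off s s≤m a₃w = [ (λ { (_ , a₃≡α) → a₃≢α a₃≡α }) , (λ { (_ , a₃≡β) → a₃≢β a₃≡β }) ]′
                           (A-attach s s≤m a₃ a₃∈A (R⇒adjacent a₃w))

      path : ChordlessPath w m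
      path = record
        { distinct = distinct
        ; edge = λ s s<m → adjacent⇒R (step s s<m)
        ; chordless = λ s t 1+s<t t≤m → proj₂ (induced s t 1+s<t t≤m) ∘ R⇒adjacent }
        where
          distinct : ∀ s t → s < t → t ≤ m → w s ≢ w t
          distinct s t s<t t≤m with t ≟ℕ suc s
          ... | yes refl = proj₁ (step s t≤m)
          ... | no t≢1+s = proj₁ (induced s t (≤∧≢⇒< s<t (t≢1+s ∘ sym)) t≤m)

      pathβ : ChordlessPath (append w m β) (suc m)
      pathβ = extend path (λ s s≤m → C≢X (inC s s≤m) (A⊆X β∈A))
                (λ s s≤m → (λ wβ → β-attach s s≤m (adjacent-sym G (R⇒adjacent wβ))) , (λ { refl → R-sym (adjacent⇒R βwₘ) }))

      offPathβ : ∀ {v} → v ∈ X → v ≢ β → ∀ s → s ≤ suc m → v ≢ append w m β s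
      offPathβ v∈X v≢β = onAppend (λ _ u → _ ≢ u) (λ s s≤m → X≢C (inC s s≤m) v∈X) v≢β

      B-attach-β : ∀ {b} → b ∈ B → (∀ s → s ≤ m → ¬ Adjacent G b (w s)) →
                   ∀ s → s ≤ suc m → R b (append w m β s) ⟺ (s ≡ suc m)
      B-attach-β {b} b∈B b-off = onAppend (λ s v → R b v ⟺ (s ≡ suc m))
        (λ s s≤m → (λ bw → ⊥-elim (b-off s s≤m (R⇒adjacent bw))) , (λ { refl → ⊥-elim (<-irrefl refl s≤m) }))
        ((λ _ → refl) , (λ _ → RBA full b∈B β∈A))

      α-attach-β : ∀ s → s ≤ suc m → R α (append w m β s) ⟺ (s ≡ 0)
      α-attach-β = onAppend (λ s v → R α v ⟺ (s ≡ 0)) α-attach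
                     ((λ αβ → ⊥-elim (¬RAA full α∈A β∈A α≢β αβ)) , λ ())

      BNeighbour : ℕ → Set
      BNeighbour l = ∃[ b ] (b ∈ B × Adjacent G b (w l))

      OtherBNeighbour : Fin n → ℕ → Set
      OtherBNeighbour b l = ∃[ b' ] (b' ∈ B × b' ≢ b × Adjacent G b' (w l))

      BNeighbour? : ∀ l → Dec (BNeighbour l)
      BNeighbour? l = any? (λ b → b ∈? B ×-dec adjacent? G b (w l))

      OtherBNeighbour? : ∀ b l → Dec (OtherBNeighbour b l)
      OtherBNeighbour? b l = any? (λ b' → b' ∈? B ×-dec (¬? (b' ≟F b) ×-dec adjacent? G b' (w l)))

      -- No vertex of B sees the path: then α, a₃ and two vertices of B
      -- with the extended path form an ISK4 (branch vertices α , β , b₁ , b₂).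
      noBNeighbour : ¬ (∃[ l ] (l ≤ m × BNeighbour l)) → ⊥
      noBNeighbour none with avoidTwo B 3≤∣B∣ α α
      ... | b₁ , b₁∈B , _ with avoidTwo B 3≤∣B∣ b₁ b₁
      ...   | b₂ , b₂∈B , b₂≢b₁ , _ = noISKConfig free config
        where
          B-off : ∀ {b} → b ∈ B → ∀ s → s ≤ m → ¬ Adjacent G b (w s)
          B-off {b} b∈B s s≤m bw = none (s , s≤m , b , b∈B , bw)
          config : ISKConfig (append w m β) (suc m) (suc m) α b₁ a₃ b₂
          config = record
            { u≤r = ≤-refl
            ; path = pathβ
            ; y-off = offPathβ (A⊆X α∈A) α≢β
            ; z₁-off = offPathβ (B⊆X b₁∈B) (A≢B β∈A b₁∈B ∘ sym)
            ; z₂-off = offPathβ (A⊆X a₃∈A) a₃≢β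
            ; z₃-off = offPathβ (B⊆X b₂∈B) (A≢B β∈A b₂∈B ∘ sym)
            ; y≢z₂ = a₃≢α ∘ sym
            ; z₁≢z₃ = b₂≢b₁ ∘ sym
            ; y-attach = α-attach-β
            ; z₁-attach = B-attach-β b₁∈B (B-off b₁∈B)
            ; z₂-attach = onAppend (λ _ v → ¬ R a₃ v) a₃-off (¬RAA full a₃∈A β∈A a₃≢β)
            ; z₃-attach = B-attach-β b₂∈B (B-off b₂∈B)
            ; yz₁ = RAB full α∈A b₁∈B
            ; yz₃ = RAB full α∈A b₂∈B
            ; ¬yz₂ = ¬RAA full α∈A a₃∈A (a₃≢α ∘ sym)
            ; z₁z₂ = RBA full b₁∈B a₃∈A
            ; z₂z₃ = RAB full a₃∈A b₂∈B
            ; ¬z₁z₃ = ¬RBB full b₁∈B b₂∈B (b₂≢b₁ ∘ sym) }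

      -- Exactly one vertex b of B sees the path: then b is the centre of
      -- a wheel with rim α – w 0 – … – w m – β – b₂ – α.
      oneBNeighbour : ∀ {i₀ b} → i₀ ≤ m → b ∈ B → Adjacent G b (w i₀) →
                      ¬ (∃[ j ] (j ≤ m × OtherBNeighbour b j)) → ⊥
      oneBNeighbour {i₀} {b} i₀≤m b∈B bwᵢ₀ none with avoidTwo B 3≤∣B∣ b b
      ... | b₂ , b₂∈B , b₂≢b , _ =
        noWheel free hole (A≢B α∈A b∈B ∘ sym)
          (onAppend (λ _ v → b ≢ v) (offPathβ (B⊆X b∈B) (A≢B β∈A b∈B ∘ sym)) (b₂≢b ∘ sym))
          {0} {suc i₀} {suc (suc m)} (s≤s z≤n) (s≤s (s≤s i₀≤m)) (n≤1+n _)
          (RBA full b∈B α∈A)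
          (subst (R b) (sym (trans (append-old {p = append w m β} {suc m} {b₂} i₀ (m≤n⇒m≤1+n i₀≤m))
                                   (append-old {p = w} {m} {β} i₀ i₀≤m))) (adjacent⇒R bwᵢ₀))
          (subst (R b) (sym (trans (append-old {p = append w m β} {suc m} {b₂} (suc m) ≤-refl)
                                   (append-new {p = w} {m} {β}))) (RBA full b∈B β∈A))
        where
          hole : Hole α (append (append w m β) (suc m) b₂) (suc (suc m))
          hole = closeHole pathβ (offPathβ (A⊆X α∈A) α≢β) (offPathβ (B⊆X b₂∈B) (A≢B β∈A b₂∈B ∘ sym))
                   α-attach-β (B-attach-β b₂∈B (λ s s≤m b₂w → none (s , s≤m , b₂ , b₂∈B , b₂≢b , b₂w)))
                   (RAB full α∈A b₂∈B)

      -- Let b see the path first (at w i₀) and b' ≠ b see it first at w j.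
      -- Then i₀ < j, and either b sees some w l with i₀ < l < j (a wheel
      -- with rim α – w 0 – … – w j – b' – α and centre b), or b attaches to
      -- w 0 … w j exactly at w i₀ (an ISK4 with branch vertices α , w i₀ , b' , b).
      twoBNeighbours : ∀ {i₀ b j b'} → i₀ ≤ m → b ∈ B → Adjacent G b (w i₀) → (∀ t → t < i₀ → ¬ BNeighbour t) →
                       j ≤ m → b' ∈ B → b' ≢ b → Adjacent G b' (w j) → (∀ t → t < j → ¬ OtherBNeighbour b t) → ⊥
      twoBNeighbours {i₀} {b} {j} {b'} i₀≤m b∈B bwᵢ₀ first j≤m b'∈B b'≢b b'wⱼ first' = byMiddle
        where
          i₀<j : i₀ < j
          i₀<j with <-cmp i₀ j
          ... | tri< i₀<j _ _ = i₀<j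
          ... | tri≈ _ refl _ = ⊥-elim (b'≢b (Other.oneNeighbourInA (inC j j≤m) b'∈B b∈B
                                                (adjacent-sym G b'wⱼ) (adjacent-sym G bwᵢ₀)))
          ... | tri> _ _ j<i₀ = ⊥-elim (first j j<i₀ (b' , b'∈B , b'wⱼ))
          ≤j⇒≤m : ∀ {s} → s ≤ j → s ≤ m
          ≤j⇒≤m s≤j = ≤-trans s≤j j≤m
          b'-attach : ∀ s → s ≤ j → R b' (w s) ⟺ (s ≡ j)
          b'-attach s s≤j =
            (λ b'w → [ (λ s<j → ⊥-elim (first' s s<j (b' , b'∈B , b'≢b , R⇒adjacent b'w))) , (λ s≡j → s≡j) ]′
                       (m≤n⇒m<n∨m≡n s≤j)) ,
            (λ { refl → adjacent⇒R b'wⱼ })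
          InMiddle : ℕ → Set
          InMiddle l = i₀ < l × l < j × Adjacent G b (w l)
          byMiddle : ⊥
          byMiddle with ∃≤? InMiddle (λ l → (i₀ <? l) ×-dec ((l <? j) ×-dec adjacent? G b (w l))) j
          ... | yes (l , _ , i₀<l , l<j , bwₗ) =
            noWheel free hole (A≢B α∈A b∈B ∘ sym)
              (onAppend (λ _ v → b ≢ v) (λ s s≤j → X≢C (inC s (≤j⇒≤m s≤j)) (B⊆X b∈B)) (b'≢b ∘ sym))
              {0} {suc i₀} {suc l} (s≤s z≤n) (s≤s i₀<l) (s≤s (m≤n⇒m≤1+n (<⇒≤ l<j)))
              (RBA full b∈B α∈A)
              (subst (R b) (sym (append-old {p = w} {j} {b'} i₀ (<⇒≤ i₀<j))) (adjacent⇒R bwᵢ₀))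
              (subst (R b) (sym (append-old {p = w} {j} {b'} l (<⇒≤ l<j))) (adjacent⇒R bwₗ))
            where
              hole : Hole α (append w j b') (suc j)
              hole = closeHole (path-prefix j j≤m path)
                       (λ s s≤j → X≢C (inC s (≤j⇒≤m s≤j)) (A⊆X α∈A))
                       (λ s s≤j → X≢C (inC s (≤j⇒≤m s≤j)) (B⊆X b'∈B))
                       (λ s s≤j → α-attach s (≤j⇒≤m s≤j)) b'-attach (RAB full α∈A b'∈B)
          ... | no notInMiddle = noISKConfig free config
            where
              b-attach : ∀ s → s ≤ j → R b (w s) ⟺ (s ≡ i₀)
              b-attach s s≤j = attached , (λ { refl → adjacent⇒R bwᵢ₀ })
                where
                  attached : R b (w s) → s ≡ i₀
                  attached bw with <-cmp s i₀
                  ... | tri< s<i₀ _ _ = ⊥-elim (first s s<i₀ (b , b∈B , R⇒adjacent bw))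
                  ... | tri≈ _ s≡i₀ _ = s≡i₀
                  ... | tri> _ _ i₀<s with m≤n⇒m<n∨m≡n s≤j
                  ...   | inj₁ s<j = ⊥-elim (notInMiddle (s , s≤j , i₀<s , s<j , R⇒adjacent bw))
                  ...   | inj₂ refl = ⊥-elim (b'≢b (Other.oneNeighbourInA (inC s j≤m) b'∈B b∈B
                                                      (adjacent-sym G b'wⱼ) (adjacent-sym G (R⇒adjacent bw))))
              config : ISKConfig w j i₀ α b' a₃ b
              config = record
                { u≤r = <⇒≤ i₀<j
                ; path = path-prefix j j≤m path
                ; y-off = λ s s≤j → X≢C (inC s (≤j⇒≤m s≤j)) (A⊆X α∈A)
                ; z₁-off = λ s s≤j → X≢C (inC s (≤j⇒≤m s≤j)) (B⊆X b'∈B)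
                ; z₂-off = λ s s≤j → X≢C (inC s (≤j⇒≤m s≤j)) (A⊆X a₃∈A)
                ; z₃-off = λ s s≤j → X≢C (inC s (≤j⇒≤m s≤j)) (B⊆X b∈B)
                ; y≢z₂ = a₃≢α ∘ sym
                ; z₁≢z₃ = b'≢b
                ; y-attach = λ s s≤j → α-attach s (≤j⇒≤m s≤j)
                ; z₁-attach = b'-attach
                ; z₂-attach = λ s s≤j → a₃-off s (≤j⇒≤m s≤j)
                ; z₃-attach = b-attach
                ; yz₁ = RAB full α∈A b'∈B
                ; yz₃ = RAB full α∈A b∈B
                ; ¬yz₂ = ¬RAA full α∈A a₃∈A (a₃≢α ∘ sym)
                ; z₁z₂ = RBA full b'∈B a₃∈A
                ; z₂z₃ = RAB full a₃∈A b∈B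
                ; ¬z₁z₃ = ¬RBB full b'∈B b∈B b'≢b }

      impossible : ⊥
      impossible with ∃≤? BNeighbour BNeighbour? m
      ... | no none = noBNeighbour none
      ... | yes some
        with leastWitness BNeighbour BNeighbour? m some
      ...   | i₀ , i₀≤m , (b , b∈B , bwᵢ₀) , first
        with ∃≤? (OtherBNeighbour b) (OtherBNeighbour? b) m
      ...     | no none = oneBNeighbour i₀≤m b∈B bwᵢ₀ none
      ...     | yes some′ with leastWitness (OtherBNeighbour b) (OtherBNeighbour? b) m some′
      ...       | j , j≤m , (b' , b'∈B , b'≢b , b'wⱼ) , first' =
                  twoBNeighbours i₀≤m b∈B bwᵢ₀ first j≤m b'∈B b'≢b b'wⱼ first'

    NoWalk : ℕ → Set
    NoWalk m = ∀ w α β → Walk w m → α ∈ A → β ∈ A → α ≢ β →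
               Adjacent G α (w 0) → Adjacent G β (w m) → ⊥

    private
      Shorter : ℕ → Set
      Shorter m = ∀ {k} → k < m → NoWalk k

    -- An interior vertex w t adjacent to γ ∈ A splits the walk: w 0 … w t
    -- joins α to γ, and w t … w m joins γ = α to β.
    splitAtA : ∀ {m} → Shorter m → ∀ {w α β} → Walk w m → α ∈ A → β ∈ A → α ≢ β →
               Adjacent G α (w 0) → Adjacent G β (w m) →
               ∀ {t γ} → 0 < t → t < m → γ ∈ A → Adjacent G γ (w t) → ⊥
    splitAtA {m} shorter {w} {α} {β} W α∈A β∈A α≢β αw₀ βwₘ {t} {γ} 0<t t<m γ∈A γwₜ with γ ≟F α
    ... | no γ≢α = shorter t<m w α γ (walk-prefix t (<⇒≤ t<m) W) α∈A γ∈A (γ≢α ∘ sym) αw₀ γwₜ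
    ... | yes refl = shorter (∸-monoʳ-< {m} {t} {0} 0<t (<⇒≤ t<m)) (λ s → w (s + t)) γ β
                       (walk-suffix t (<⇒≤ t<m) W) γ∈A β∈A α≢β γwₜ
                       (subst (Adjacent G β ∘ w) (sym (m∸n+n≡m (<⇒≤ t<m))) βwₘ)

    -- A chord w i – w j (i + 1 < j) is a shortcut.
    cutChord : ∀ {m} → Shorter m → ∀ {w α β} → Walk w m → α ∈ A → β ∈ A → α ≢ β →
               Adjacent G α (w 0) → Adjacent G β (w m) →
               ∀ {i j} → suc i < j → j ≤ m → Adjacent G (w i) (w j) → ⊥
    cutChord {m} shorter {w} {α} {β} W α∈A β∈A α≢β αw₀ βwₘ {i} {j} 1+i<j j≤m wᵢwⱼ =
      shorter (Cut.shorter (m<n⇒0<n∸m 1+i<j)) Cut.w′ α β (Cut.walk jump) α∈A β∈A α≢β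
        (subst (Adjacent G α) (sym Cut.start) αw₀) (subst (Adjacent G β) (sym (Cut.end last)) βwₘ)
      where
        d = j ∸ suc i
        1+i+d≡j : suc i + d ≡ j
        1+i+d≡j = m+[n∸m]≡n (<⇒≤ 1+i<j)
        1+i+d≤m : suc i + d ≤ m
        1+i+d≤m = subst (_≤ m) (sym 1+i+d≡j) j≤m
        module Cut = Shortcut W i d (≤-trans (n≤1+n (i + d)) 1+i+d≤m)
        jump : i < Cut.m′ → Adjacent G (w i) (w (suc i + d))
        jump _ = subst (Adjacent G (w i) ∘ w) (sym 1+i+d≡j) wᵢwⱼ
        last : Cut.m′ ≡ i → w i ≡ w m
        last m′≡i = ⊥-elim (<-irrefl (sym m′≡i) (m+n≤o⇒m≤o∸n (suc i) 1+i+d≤m))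

    -- A repetition w i = w j (i + 1 < j) is a shortcut.
    cutRepeat : ∀ {m} → Shorter m → ∀ {w α β} → Walk w m → α ∈ A → β ∈ A → α ≢ β →
                Adjacent G α (w 0) → Adjacent G β (w m) →
                ∀ {i j} → suc i < j → j ≤ m → w i ≡ w j → ⊥
    cutRepeat {m} shorter {w} {α} {β} W α∈A β∈A α≢β αw₀ βwₘ {i} {j} 1+i<j j≤m wᵢ≡wⱼ =
      shorter (Cut.shorter (m<n⇒0<n∸m (<-trans (n<1+n i) 1+i<j))) Cut.w′ α β (Cut.walk jump) α∈A β∈A α≢β
        (subst (Adjacent G α) (sym Cut.start) αw₀) (subst (Adjacent G β) (sym (Cut.end last)) βwₘ)
      where
        d = j ∸ i
        i+d≡j : i + d ≡ j
        i+d≡j = m+[n∸m]≡n (≤-trans (n≤1+n i) (<⇒≤ 1+i<j))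
        module Cut = Shortcut W i d (subst (_≤ m) (sym i+d≡j) j≤m)
        jump : i < Cut.m′ → Adjacent G (w i) (w (suc i + d))
        jump i<m′ = subst₂ (Adjacent G) (sym wᵢ≡wⱼ) (cong (w ∘ suc) (sym i+d≡j))
                      (Walk.step W j (subst (λ k → suc k ≤ m) i+d≡j (m≤o∸n⇒m+n≤o (suc i) Cut.d≤m i<m′)))
        last : Cut.m′ ≡ i → w i ≡ w m
        last m′≡i = trans wᵢ≡wⱼ (cong w (trans (sym i+d≡j) (trans (cong (_+ d) (sym m′≡i)) (m∸n+n≡m Cut.d≤m))))

    private
      InteriorA : (ℕ → Fin n) → ℕ → ℕ → Set
      InteriorA w m t = 0 < t × t < m × ∃[ γ ] (γ ∈ A × Adjacent G γ (w t))

      InteriorA? : ∀ w m t → Dec (InteriorA w m t)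
      InteriorA? w m t = (0 <? t) ×-dec ((t <? m) ×-dec any? (λ γ → γ ∈? A ×-dec adjacent? G γ (w t)))

      Shortcuttable : (ℕ → Fin n) → ℕ → Set
      Shortcuttable w j = ∃[ i ] (i ≤ j × suc i < j × (w i ≡ w j ⊎ Adjacent G (w i) (w j)))

      Shortcuttable? : ∀ w j → Dec (Shortcuttable w j)
      Shortcuttable? w j = ∃≤? (λ i → suc i < j × (w i ≡ w j ⊎ Adjacent G (w i) (w j)))
                             (λ i → (suc i <? j) ×-dec ((w i ≟F w j) ⊎-dec adjacent? G (w i) (w j))) j

    -- By induction on the length: a walk with an interior A-neighbour, a
    -- chord or a repetition yields a shorter walk; otherwise it is a clean path.
    noWalk : ∀ m → NoWalk m
    noWalk = <-rec NoWalk step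
      where
        step : ∀ m → Shorter m → NoWalk m
        step m shorter w α β W α∈A β∈A α≢β αw₀ βwₘ
          with ∃≤? (InteriorA w m) (InteriorA? w m) m
        ... | yes (t , _ , 0<t , t<m , γ , γ∈A , γwₜ) = splitAtA shorter W α∈A β∈A α≢β αw₀ βwₘ 0<t t<m γ∈A γwₜ
        ... | no noInteriorA with ∃≤? (Shortcuttable w) (Shortcuttable? w) m
        ...   | yes (j , j≤m , i , _ , 1+i<j , inj₁ wᵢ≡wⱼ) = cutRepeat shorter W α∈A β∈A α≢β αw₀ βwₘ 1+i<j j≤m wᵢ≡wⱼ
        ...   | yes (j , j≤m , i , _ , 1+i<j , inj₂ wᵢwⱼ) = cutChord shorter W α∈A β∈A α≢β αw₀ βwₘ 1+i<j j≤m wᵢwⱼ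
        ...   | no noShortcut = CleanPath.impossible W α∈A β∈A α≢β αw₀ βwₘ
                  (λ t 0<t t<m γ γ∈A γwₜ → noInteriorA (t , <⇒≤ t<m , 0<t , t<m , γ , γ∈A , γwₜ))
                  (λ i j 1+i<j j≤m → let i≤j = ≤-trans (n≤1+n i) (<⇒≤ 1+i<j) in
                     (λ wᵢ≡wⱼ → noShortcut (j , j≤m , i , i≤j , 1+i<j , inj₁ wᵢ≡wⱼ)) ,
                     (λ wᵢwⱼ → noShortcut (j , j≤m , i , i≤j , 1+i<j , inj₂ wᵢwⱼ)))

    attachment-A : ∀ a a' → a ∈ A → a' ∈ A → InAttachment G X C a → InAttachment G X C a' → a ≡ a'
    attachment-A a a' a∈A a'∈A (_ , c , c∈C , ac) (_ , c' , c'∈C , a'c') with a ≟F a'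
    ... | yes a≡a' = a≡a'
    ... | no a≢a' with walkFromStar c∈C (C-connected c c' c∈C c'∈C)
    ...   | m , w , W , w₀≡c , wₘ≡c' =
            ⊥-elim (noWalk m w a a' W a∈A a'∈A a≢a'
                      (subst (Adjacent G a) (sym w₀≡c) ac) (subst (Adjacent G a') (sym wₘ≡c') a'c'))

proposition4p17 : (n : ℕ) (G : Trigraph n) → ISK4WheelFree G →
    (X : Subset n) → IsMaximalThickCB G X →
    (A B : Subset n) → IsBipartition G X A B →
    (C : Subset n) → IsComponentOfMinus G X C →
    ((a a' : Fin n) → a ∈ A → a' ∈ A →
        InAttachment G X C a → InAttachment G X C a' → a ≡ a')
    × ((b b' : Fin n) → b ∈ B → b' ∈ B →
        InAttachment G X C b → InAttachment G X C b' → b ≡ b')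
proposition4p17 n G free X maxX A B bip C comp =
  Attachment.attachment-A A B bip 3≤∣A∣ 3≤∣B∣ ,
  Attachment.attachment-A B A (swapBipartition {G = G} {X} {A} {B} bip) 3≤∣B∣ 3≤∣A∣
  where
    open Setting G free X maxX C comp
    -- (A , B) is thick because X is, with whatever bipartition.
    3≤∣A∣×3≤∣B∣ : 3 ≤ ∣ A ∣ × 3 ≤ ∣ B ∣
    3≤∣A∣×3≤∣B∣ = bipartition-thick {G = G} {X} {A} {B} (proj₁ maxX) bip
    3≤∣A∣ : 3 ≤ ∣ A ∣
    3≤∣A∣ = proj₁ 3≤∣A∣×3≤∣B∣
    3≤∣B∣ : 3 ≤ ∣ B ∣
    3≤∣B∣ = proj₂ 3≤∣A∣×3≤∣B∣
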